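{- Let $F$ be a finite field with $q$ elements and let $V$ be a vector space over $F$ of finite dimension $n\ge 1$. Then the number of spanning trees of the linear dependence graph $\Gamma(V)$ is $q^{(q-2)(q^{n-1}+\cdots+q+1)}$.
   Context: For a finite-dimensional vector space $V$ over a finite field $F$, the linear dependence graph $\Gamma(V)$ is the simple graph whose vertex set is $V$, two vertices $a,b$ being adjacent if and only if $a\neq b$ and $\{a,b\}$ is linearly dependent. -}

module Defs where

open import Level using (Level; _⊔_) renaming (suc to lsuc)
open import Data.Bool using (Bool; true)
import Data.Nat as ℕ
open ℕ using (ℕ; zero; suc; _^_)
open import Data.Fin using (Fin; zero; suc; inject₁; fromℕ)
open import Data.List using (map; upTo)
open import Data.Nat.ListAction using (sum)
open import Data.Product using (Σ; ∃; _×_; _,_)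
open import Relation.Nullary using (¬_)
open import Relation.Binary using (Setoid; Rel; IsEquivalence)
open import Relation.Binary.PropositionalEquality as ≡ using (_≡_)
open import Function.Bundles using (Inverse)
open import Algebra.Bundles using (CommutativeRing)

private
  variable
    a ℓ r c : Level

record IsField (R : CommutativeRing c ℓ) : Set (c ⊔ ℓ) where
  open CommutativeRing R
  field
    0≉1     : ¬ (0# ≈ 1#)
    inverse : ∀ x → ¬ (x ≈ 0#) → ∃ λ y → x * y ≈ 1#

HasCardinality : (R : CommutativeRing c ℓ) → ℕ → Set (c ⊔ ℓ)
HasCardinality R q = Inverse (≡.setoid (Fin q)) (CommutativeRing.setoid R)

module _ (S : Setoid a ℓ) where
  open Setoid S renaming (Carrier to V)

  data Walk (E : V → V → Bool) : V → V → Set (a ⊔ ℓ) where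
    here : ∀ {u v} → u ≈ v → Walk E u v
    step : ∀ {u w v} → E u w ≡ true → Walk E w v → Walk E u v

  -- a cycle: k+3 pairwise distinct vertices c₀ … c_{k+2} with
  -- c_i c_{i+1} edges and c_{k+2} c₀ an edge
  HasCycle : (E : V → V → Bool) → Set (a ⊔ ℓ)
  HasCycle E = Σ ℕ λ k → Σ (Fin (3 ℕ.+ k) → V) λ cyc →
      (∀ i j → cyc i ≈ cyc j → i ≡ j)
    × (∀ (i : Fin (2 ℕ.+ k)) → E (cyc (inject₁ i)) (cyc (suc i)) ≡ true)
    × (E (cyc (fromℕ (2 ℕ.+ k))) (cyc zero) ≡ true)

  record SpanningTree (Adj : Rel V r) : Set (a ⊔ ℓ ⊔ r) where
    field
      E         : V → V → Bool
      E-resp    : ∀ {u u' v v'} → u ≈ u' → v ≈ v' → E u v ≡ E u' v'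
      E-sym     : ∀ u v → E u v ≡ E v u
      E⊆Adj     : ∀ u v → E u v ≡ true → Adj u v
      connected : ∀ u v → Walk E u v
      acyclic   : ¬ HasCycle E

  SpanningTreeSetoid : (Adj : Rel V r) → Setoid (a ⊔ ℓ ⊔ r) a
  SpanningTreeSetoid Adj = record
    { Carrier = SpanningTree Adj
    ; _≈_ = λ T T' → ∀ u v → SpanningTree.E T u v ≡ SpanningTree.E T' u v
    ; isEquivalence = record
      { refl = λ u v → ≡.refl
      ; sym = λ p u v → ≡.sym (p u v)
      ; trans = λ p q u v → ≡.trans (p u v) (q u v) } }

  NumberOfSpanningTrees : (Adj : Rel V r) → ℕ → Set (a ⊔ ℓ ⊔ r)
  NumberOfSpanningTrees Adj m = Inverse (≡.setoid (Fin m)) (SpanningTreeSetoid Adj)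

module _ (R : CommutativeRing c ℓ) (n : ℕ) where
  open CommutativeRing R

  VecSetoid : Setoid c ℓ
  VecSetoid = record
    { Carrier = Fin n → Carrier
    ; _≈_ = λ x y → ∀ i → x i ≈ y i
    ; isEquivalence = record
      { refl = λ i → refl
      ; sym = λ p i → sym (p i)
      ; trans = λ p q i → trans (p i) (q i) } }

  LinDep : (x y : Fin n → Carrier) → Set (c ⊔ ℓ)
  LinDep x y = Σ Carrier λ λ₁ → Σ Carrier λ λ₂ →
      ¬ (λ₁ ≈ 0# × λ₂ ≈ 0#)
    × (∀ i → λ₁ * x i + λ₂ * y i ≈ 0#)

  ΓAdj : Rel (Fin n → Carrier) (c ⊔ ℓ)
  ΓAdj x y = ¬ (∀ i → x i ≈ y i) × LinDep x y

geomSum : ℕ → ℕ → ℕ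
geomSum q n = sum (map (q ^_) (upTo n))

-- In Γ(Fⁿ) the zero vector is adjacent to every other vector, and two nonzero vectors
-- are adjacent iff they span the same line. So Γ(Fⁿ) is a windmill: a hub joined to the
-- L = 1 + q + ⋯ + qⁿ⁻¹ lines, each line contributing a clique on its q − 1 nonzero vectors.
-- Rooting a spanning tree at the hub, the parent of a nonzero vector lies on its own line or is
-- the hub, so spanning trees of the windmill are exactly L-tuples of rooted forests on q − 1
-- labelled vertices, i.e. of spanning trees of K_q. Cayley's formula, proved with Prüfer codes,
-- counts q^(q−2) of these for each line.

module Submission where

module CayleyFormula where

  open import Data.Nat using (ℕ; zero; suc; _^_)
  open import Data.Nat.Properties using (n<1+n)
  open import Data.Fin using (Fin; zero; suc; punchIn; punchOut; finToFun; funToFin; combine)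
  open import Data.Fin.Properties
    using (_≟_; punchIn-injective; punchInᵢ≢i; punchIn-punchOut; punchOut-injective; pigeonhole; <⇒≢;
           funToFin-finToFin; finToFun-funToFin)
  open import Data.Maybe using (Maybe; just; nothing)
  open import Data.Maybe.Properties using (just-injective) renaming (≡-dec to ≡-decᴹ)
  open import Data.Bool using (Bool; true; false; not; _∨_; if_then_else_)
  open import Data.Bool.Properties using (∨-assoc; ∨-comm; ∨-conicalˡ; ∨-conicalʳ; not-injective)
  open import Data.Vec using (Vec; []; _∷_; lookup; tabulate)
  open import Data.Vec.Properties using (lookup∘tabulate; tabulate∘lookup; tabulate-cong)
  open import Data.Vec.Relation.Unary.All using (All; []; _∷_; universal) renaming (map to All-map)
  open import Data.Vec.Functional.Relation.Binary.Equality.Setoid using (≋-setoid)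
  open import Data.Product using (Σ; ∃; _,_; proj₁; proj₂)
  open import Data.Sum using (_⊎_; inj₁; inj₂)
  open import Data.Empty using (⊥; ⊥-elim)
  open import Level using (0ℓ)
  open import Relation.Nullary using (¬_; yes; no; does; contradiction)
  open import Relation.Nullary.Decidable using (dec-true; dec-false)
  open import Relation.Binary using (Setoid; DecidableEquality)
  import Relation.Binary.Construct.On as On
  open import Relation.Binary.PropositionalEquality as ≡
    using (_≡_; _≢_; _≗_; refl; sym; trans; cong; cong₂; subst)
  open import Function using (_∘_; id)
  open import Function.Definitions using (Injective)
  open import Function.Bundles using (Inverse)
  import Function.Construct.Composition as Comp

  module BoolEquality {a} {A : Set a} (_≟ᴬ_ : DecidableEquality A) where

    infix 6 _==_
    _==_ : A → A → Bool
    x == y = does (x ≟ᴬ y)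

    ==⇒≡ : ∀ x y → x == y ≡ true → x ≡ y
    ==⇒≡ x y e with x ≟ᴬ y
    ... | yes p = p

    ==-refl : ∀ x → x == x ≡ true
    ==-refl x = dec-true (x ≟ᴬ x) refl

    ≢⇒==-false : ∀ {x y} → x ≢ y → x == y ≡ false
    ≢⇒==-false {x} {y} = dec-false (x ≟ᴬ y)

    ==-false⇒≢ : ∀ {x y} → x == y ≡ false → x ≢ y
    ==-false⇒≢ {x} e refl = contradiction (trans (sym (==-refl x)) e) λ ()

  module FinSearch where

    anyᵇ : ∀ {k} → (Fin k → Bool) → Bool
    anyᵇ {zero} p = false
    anyᵇ {suc k} p = p zero ∨ anyᵇ (p ∘ suc)

    -- the first index at which p holds, and zero if there is none
    first : ∀ {k} → (Fin (suc k) → Bool) → Fin (suc k)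
    first {zero} p = zero
    first {suc k} p = if p zero then zero else suc (first (p ∘ suc))

    anyᵇ-cong : ∀ {k} {p q : Fin k → Bool} → p ≗ q → anyᵇ p ≡ anyᵇ q
    anyᵇ-cong {zero} h = refl
    anyᵇ-cong {suc k} h = cong₂ _∨_ (h zero) (anyᵇ-cong (h ∘ suc))

    anyᵇ-true⁺ : ∀ {k} (p : Fin k → Bool) i → p i ≡ true → anyᵇ p ≡ true
    anyᵇ-true⁺ p zero e rewrite e = refl
    anyᵇ-true⁺ p (suc i) e rewrite anyᵇ-true⁺ (p ∘ suc) i e with p zero
    ... | true = refl
    ... | false = refl

    anyᵇ-true⁻ : ∀ {k} (p : Fin k → Bool) → anyᵇ p ≡ true → ∃ λ i → p i ≡ true
    anyᵇ-true⁻ {suc k} p e with p zero in eq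
    ... | true = zero , eq
    ... | false = let (i , h) = anyᵇ-true⁻ (p ∘ suc) e in suc i , h

    anyᵇ-false⁺ : ∀ {k} (p : Fin k → Bool) → (∀ i → p i ≡ false) → anyᵇ p ≡ false
    anyᵇ-false⁺ {zero} p h = refl
    anyᵇ-false⁺ {suc k} p h rewrite h zero = anyᵇ-false⁺ (p ∘ suc) (h ∘ suc)

    anyᵇ-false⁻ : ∀ {k} (p : Fin k → Bool) → anyᵇ p ≡ false → ∀ i → p i ≡ false
    anyᵇ-false⁻ p e i with p i in eq
    ... | false = refl
    ... | true = trans (sym (anyᵇ-true⁺ p i eq)) e

    anyᵇ-punchIn : ∀ {k} (p : Fin (suc k) → Bool) (ℓ : Fin (suc k)) →
      anyᵇ p ≡ p ℓ ∨ anyᵇ (p ∘ punchIn ℓ)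
    anyᵇ-punchIn p zero = refl
    anyᵇ-punchIn {suc k} p (suc ℓ) rewrite anyᵇ-punchIn (p ∘ suc) ℓ =
      trans (sym (∨-assoc (p zero) (p (suc ℓ)) _))
        (trans (cong (_∨ anyᵇ (p ∘ suc ∘ punchIn ℓ)) (∨-comm (p zero) (p (suc ℓ))))
          (∨-assoc (p (suc ℓ)) (p zero) _))

    first-true : ∀ {k} (p : Fin (suc k) → Bool) i → p i ≡ true → p (first p) ≡ true
    first-true {zero} p zero e = e
    first-true {suc k} p i e with p zero in eq
    ... | true = eq
    first-true {suc k} p zero e | false = contradiction (trans (sym eq) e) λ ()
    first-true {suc k} p (suc i) e | false = first-true (p ∘ suc) i e

    first-cong : ∀ {k} {p q : Fin (suc k) → Bool} → p ≗ q → first p ≡ first q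
    first-cong {zero} h = refl
    first-cong {suc k} {p} {q} h rewrite h zero with q zero
    ... | true = refl
    ... | false = cong suc (first-cong (h ∘ suc))

    first-false : ∀ {k} (p : Fin (suc k) → Bool) → ¬ (∀ i → p i ≡ true) → p (first (not ∘ p)) ≡ false
    first-false p ¬all with anyᵇ (not ∘ p) in eq
    ... | true = let (i , h) = anyᵇ-true⁻ (not ∘ p) eq in not-injective (first-true (not ∘ p) i h)
    ... | false = ⊥-elim (¬all λ i → not-injective (anyᵇ-false⁻ (not ∘ p) eq i))

  module Prüfer where

    open FinSearch

    ParentMap : ℕ → Set
    ParentMap M = Fin M → Maybe (Fin M)

    -- nothing stands for the root, which lies outside Fin M
    data ReachesRoot {M} (f : ParentMap M) : Maybe (Fin M) → Set where
      root : ReachesRoot f nothing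
      up   : ∀ {a} → ReachesRoot f (f a) → ReachesRoot f (just a)

    reachesRoot⇒noFixedPoint : ∀ {M} {f : ParentMap M} {x a} → ReachesRoot f x → x ≡ just a → f a ≢ just a
    reachesRoot⇒noFixedPoint (up r) refl fa = reachesRoot⇒noFixedPoint r fa fa

    Code : ℕ → ℕ → Set
    Code M s = Vec (Maybe (Fin M)) s

    ≡⊎punchIn : ∀ {s} (ℓ i : Fin (suc s)) → i ≡ ℓ ⊎ ∃ λ j → i ≡ punchIn ℓ j
    ≡⊎punchIn ℓ i with ℓ ≟ i
    ... | yes refl = inj₁ refl
    ... | no ℓ≢i = inj₂ (punchOut ℓ≢i , sym (punchIn-punchOut ℓ≢i))

    -- A forest is encoded on any injectively labelled vertex set e; the recursion
    -- removes one vertex at a time, relabelling the rest by e ∘ punchIn ℓ.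
    module _ {M : ℕ} where

      open BoolEquality (≡-decᴹ (_≟_ {M}))

      Among : ∀ {s} → (Fin (suc s) → Fin M) → Maybe (Fin M) → Set
      Among e x = x ≡ nothing ⊎ ∃ λ j → x ≡ just (e j)

      record IsForestOn {s} (e : Fin (suc s) → Fin M) (f : ParentMap M) : Set where
        constructor forest
        field
          parent-among : ∀ i → Among e (f (e i))
          reaches-root : ∀ i → ReachesRoot f (just (e i))

      hasChildᵇ : ∀ {s} → ParentMap M → (Fin (suc s) → Fin M) → Fin (suc s) → Bool
      hasChildᵇ f e i = anyᵇ (λ j → f (e j) == just (e i))

      occursᵇ : ∀ {s} → Fin M → Code M s → Bool
      occursᵇ u [] = false
      occursᵇ u (x ∷ c) = x == just u ∨ occursᵇ u c

      occursᵇ⇒lookup : ∀ {s} u (c : Code M s) → occursᵇ u c ≡ true → ∃ λ k → lookup c k ≡ just u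
      occursᵇ⇒lookup u (x ∷ c) e with x == just u in eq
      ... | true = zero , ==⇒≡ x (just u) eq
      ... | false = let (k , h) = occursᵇ⇒lookup u c e in suc k , h

      open IsForestOn public

      module _ {s} (e : Fin (suc (suc s)) → Fin M) (ℓ : Fin (suc (suc s))) where

        among-punchIn⁻ : ∀ {x} → Among e x → x ≢ just (e ℓ) → Among (e ∘ punchIn ℓ) x
        among-punchIn⁻ (inj₁ p) _ = inj₁ p
        among-punchIn⁻ (inj₂ (j , p)) x≢ℓ with ≡⊎punchIn ℓ j
        ... | inj₁ refl = contradiction p x≢ℓ
        ... | inj₂ (j′ , refl) = inj₂ (j′ , p)

        among-punchIn⁺ : ∀ {x} → Among (e ∘ punchIn ℓ) x → Among e x
        among-punchIn⁺ (inj₁ p) = inj₁ p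
        among-punchIn⁺ (inj₂ (j , p)) = inj₂ (punchIn ℓ j , p)

        all-among-punchIn⁻ : ∀ {k} {c : Code M k} → All (Among e) c → occursᵇ (e ℓ) c ≡ false →
          All (Among (e ∘ punchIn ℓ)) c
        all-among-punchIn⁻ [] _ = []
        all-among-punchIn⁻ (a ∷ as) o =
          among-punchIn⁻ a (==-false⇒≢ (∨-conicalˡ _ _ o)) ∷ all-among-punchIn⁻ as (∨-conicalʳ _ _ o)

        isForestOn-punchIn : ∀ {f} → IsForestOn e f → hasChildᵇ f e ℓ ≡ false → IsForestOn (e ∘ punchIn ℓ) f
        isForestOn-punchIn {f} (forest among reach) noChild = forest
          (λ j → among-punchIn⁻ (among (punchIn ℓ j))
                   (==-false⇒≢ (anyᵇ-false⁻ (λ j → f (e j) == just (e ℓ)) noChild (punchIn ℓ j))))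
          (reach ∘ punchIn ℓ)

      module _ {s} (e : Fin (suc (suc s)) → Fin M) (e-inj : Injective _≡_ _≡_ e) (ℓ : Fin (suc (suc s))) where

        punchIn-injective′ : Injective _≡_ _≡_ (e ∘ punchIn ℓ)
        punchIn-injective′ = punchIn-injective ℓ _ _ ∘ e-inj

        punchIn-label≢ : ∀ j → e (punchIn ℓ j) ≢ e ℓ
        punchIn-label≢ j = punchInᵢ≢i ℓ j ∘ e-inj

        among-punchIn⇒≢ : ∀ {x} → Among (e ∘ punchIn ℓ) x → x == just (e ℓ) ≡ false
        among-punchIn⇒≢ (inj₁ refl) = refl
        among-punchIn⇒≢ (inj₂ (j , refl)) = ≢⇒==-false (punchIn-label≢ j ∘ just-injective)

        occurs-removed : ∀ {k} {c : Code M k} → All (Among (e ∘ punchIn ℓ)) c → occursᵇ (e ℓ) c ≡ false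
        occurs-removed [] = refl
        occurs-removed (a ∷ as) rewrite among-punchIn⇒≢ a = occurs-removed as

      leaf : ∀ {s} → ParentMap M → (Fin (suc (suc s)) → Fin M) → Fin (suc (suc s))
      leaf f e = first (not ∘ hasChildᵇ f e)

      absent : ∀ {s} → (Fin (suc (suc s)) → Fin M) → Code M (suc s) → Fin (suc (suc s))
      absent e c = first (not ∘ λ i → occursᵇ (e i) c)

      encode : ∀ s → (Fin (suc s) → Fin M) → ParentMap M → Code M s
      encode zero e f = []
      encode (suc s) e f = f (e (leaf f e)) ∷ encode s (e ∘ punchIn (leaf f e)) f

      override : Fin M → Maybe (Fin M) → ParentMap M → ParentMap M
      override u x g v = if does (v ≟ u) then x else g v

      override-same : ∀ u x g → override u x g u ≡ x
      override-same u x g rewrite dec-true (u ≟ u) refl = refl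

      override-other : ∀ u x g {v} → v ≢ u → override u x g v ≡ g v
      override-other u x g {v} v≢u rewrite dec-false (v ≟ u) v≢u = refl

      decode : ∀ s → (Fin (suc s) → Fin M) → Code M s → ParentMap M
      decode zero e [] = λ _ → nothing
      decode (suc s) e (x ∷ c) = override (e ℓ) x (decode s (e ∘ punchIn ℓ) c)
        where ℓ = absent e (x ∷ c)

      decode-step : ∀ {s} (e : Fin (suc (suc s)) → Fin M) x c {ℓ} → absent e (x ∷ c) ≡ ℓ →
        decode (suc s) e (x ∷ c) ≗ override (e ℓ) x (decode s (e ∘ punchIn ℓ) c)
      decode-step e x c refl v = refl

      root-child : ∀ {s} (e : Fin (suc s) → Fin M) {f} → (∀ i → Among e (f (e i))) →
        ∀ {x} → ReachesRoot f x → ∀ i → x ≡ just (e i) → ∃ λ r → f (e r) ≡ nothing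
      root-child e among (up r) i refl with among i
      ... | inj₁ p = i , p
      ... | inj₂ (j , p) = root-child e among r j p

      -- pigeonhole: distinct vertices have distinct children, and none of them is the root's child r
      not-all-hasChild : ∀ {s} (e : Fin (suc (suc s)) → Fin M) {f} → Injective _≡_ _≡_ e → IsForestOn e f →
        ¬ (∀ i → hasChildᵇ f e i ≡ true)
      not-all-hasChild {s} e {f} e-inj (forest among reach) all = collision
        where
          child : ∀ i → ∃ λ j → f (e j) ≡ just (e i)
          child i = let (j , h) = anyᵇ-true⁻ (λ j → f (e j) == just (e i)) (all i) in j , ==⇒≡ (f (e j)) (just (e i)) h
          r : ∃ λ r → f (e r) ≡ nothing
          r = root-child e among (reach zero) zero refl
          r≢child : ∀ i → proj₁ r ≢ proj₁ (child i)
          r≢child i eq = contradiction (trans (sym (proj₂ r)) (trans (cong (f ∘ e) eq) (proj₂ (child i)))) λ ()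
          collision : ⊥
          collision with pigeonhole (n<1+n (suc s)) (λ i → punchOut (r≢child i))
          ... | i , j , i<j , eq = <⇒≢ i<j (e-inj (just-injective (trans (sym (proj₂ (child i)))
                (trans (cong (f ∘ e) (punchOut-injective (r≢child i) (r≢child j) eq)) (proj₂ (child j))))))

      not-all-occur : ∀ {s} (e : Fin (suc (suc s)) → Fin M) → Injective _≡_ _≡_ e → (c : Code M (suc s)) →
        ¬ (∀ i → occursᵇ (e i) c ≡ true)
      not-all-occur {s} e e-inj c all = collision
        where
          position : ∀ i → ∃ λ k → lookup c k ≡ just (e i)
          position i = occursᵇ⇒lookup (e i) c (all i)
          collision : ⊥
          collision with pigeonhole (n<1+n (suc s)) (proj₁ ∘ position)
          ... | i , j , i<j , eq = <⇒≢ i<j (e-inj (just-injective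
                (trans (sym (proj₂ (position i))) (trans (cong (lookup c) eq) (proj₂ (position j))))))

      leaf-hasNoChild : ∀ {s} (e : Fin (suc (suc s)) → Fin M) {f} → Injective _≡_ _≡_ e → IsForestOn e f →
        hasChildᵇ f e (leaf f e) ≡ false
      leaf-hasNoChild e e-inj F = first-false _ (not-all-hasChild e e-inj F)

      absent-occursNot : ∀ {s} (e : Fin (suc (suc s)) → Fin M) → Injective _≡_ _≡_ e → ∀ c →
        occursᵇ (e (absent e c)) c ≡ false
      absent-occursNot e e-inj c = first-false _ (not-all-occur e e-inj c)

      encode-step : ∀ {s} (e : Fin (suc (suc s)) → Fin M) {f ℓ} → leaf f e ≡ ℓ →
        encode (suc s) e f ≡ f (e ℓ) ∷ encode s (e ∘ punchIn ℓ) f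
      encode-step e refl = refl

      encode-cong : ∀ s (e : Fin (suc s) → Fin M) {f g} → (∀ i → f (e i) ≡ g (e i)) → encode s e f ≡ encode s e g
      encode-cong zero e eq = refl
      encode-cong (suc s) e {f} {g} eq = trans (encode-step e leaf≡)
          (cong₂ _∷_ (eq (leaf g e)) (encode-cong s (e ∘ punchIn (leaf g e)) (eq ∘ punchIn (leaf g e))))
        where
          leaf≡ : leaf f e ≡ leaf g e
          leaf≡ = first-cong λ i → cong not (anyᵇ-cong λ j → cong (_== just (e i)) (eq j))

      module LeafRemoval {s} (e : Fin (suc (suc s)) → Fin M) {f} (e-inj : Injective _≡_ _≡_ e)
                         (F : IsForestOn e f) where

        ℓ : Fin (suc (suc s))
        ℓ = leaf f e

        e′ : Fin (suc s) → Fin M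
        e′ = e ∘ punchIn ℓ

        e′-inj : Injective _≡_ _≡_ e′
        e′-inj = punchIn-injective′ e e-inj ℓ

        ℓ-hasNoChild : hasChildᵇ f e ℓ ≡ false
        ℓ-hasNoChild = leaf-hasNoChild e e-inj F

        F′ : IsForestOn e′ f
        F′ = isForestOn-punchIn e ℓ F ℓ-hasNoChild

      encode-among : ∀ s (e : Fin (suc s) → Fin M) {f} → Injective _≡_ _≡_ e → IsForestOn e f →
        All (Among e) (encode s e f)
      encode-among zero e _ _ = []
      encode-among (suc s) e e-inj F =
        parent-among F ℓ ∷ All-map (among-punchIn⁺ e ℓ) (encode-among s e′ e′-inj F′)
        where open LeafRemoval e e-inj F

      occurs-encode : ∀ s (e : Fin (suc s) → Fin M) {f} → Injective _≡_ _≡_ e → IsForestOn e f →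
        ∀ i → occursᵇ (e i) (encode s e f) ≡ hasChildᵇ f e i
      occurs-encode zero e e-inj F zero =
        sym (cong (_∨ false) (≢⇒==-false (reachesRoot⇒noFixedPoint (reaches-root F zero) refl)))
      occurs-encode (suc s) e {f} e-inj F i =
        trans (cong (f (e ℓ) == just (e i) ∨_) rest) (sym (anyᵇ-punchIn (λ j → f (e j) == just (e i)) ℓ))
        where
          open LeafRemoval e e-inj F
          rest : occursᵇ (e i) (encode s e′ f) ≡ anyᵇ (λ j → f (e′ j) == just (e i))
          rest with ≡⊎punchIn ℓ i
          ... | inj₁ refl = trans (occurs-removed e e-inj ℓ (encode-among s e′ e′-inj F′))
                (sym (∨-conicalʳ (f (e ℓ) == just (e ℓ)) _ (trans (sym (anyᵇ-punchIn (λ j → f (e j) == just (e ℓ)) ℓ)) ℓ-hasNoChild)))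
          ... | inj₂ (i′ , refl) = occurs-encode s e′ e′-inj F′ i′

      reachesRoot-transfer : ∀ {s} (e : Fin (suc s) → Fin M) {f g} → (∀ j → f (e j) ≡ g (e j)) →
        (∀ j → Among e (g (e j))) → ∀ {x} → Among e x → ReachesRoot g x → ReachesRoot f x
      reachesRoot-transfer e f≡g among (inj₁ refl) root = root
      reachesRoot-transfer e {f} f≡g among (inj₂ (j , refl)) (up r) =
        up (subst (ReachesRoot f) (sym (f≡g j)) (reachesRoot-transfer e f≡g among (among j) r))

      among⇒reachesRoot : ∀ {s} (e : Fin (suc s) → Fin M) {f} → (∀ j → ReachesRoot f (just (e j))) →
        ∀ {x} → Among e x → ReachesRoot f x
      among⇒reachesRoot e reach (inj₁ refl) = root
      among⇒reachesRoot e reach (inj₂ (j , refl)) = reach j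

      module DecodeStep {s} (e : Fin (suc (suc s)) → Fin M) (e-inj : Injective _≡_ _≡_ e)
                        (x : Maybe (Fin M)) (c : Code M s) where

        ℓ : Fin (suc (suc s))
        ℓ = absent e (x ∷ c)

        e′ : Fin (suc s) → Fin M
        e′ = e ∘ punchIn ℓ

        e′-inj : Injective _≡_ _≡_ e′
        e′-inj = punchIn-injective′ e e-inj ℓ

        ℓ-absent : occursᵇ (e ℓ) (x ∷ c) ≡ false
        ℓ-absent = absent-occursNot e e-inj (x ∷ c)

        x≢ℓ : x ≢ just (e ℓ)
        x≢ℓ = ==-false⇒≢ (∨-conicalˡ _ _ ℓ-absent)

        all-among′ : All (Among e) c → All (Among e′) c
        all-among′ ac = all-among-punchIn⁻ e ℓ ac (∨-conicalʳ _ _ ℓ-absent)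

        decode-punchIn : ∀ j → decode (suc s) e (x ∷ c) (e′ j) ≡ decode s e′ c (e′ j)
        decode-punchIn j = override-other (e ℓ) x (decode s e′ c) (punchIn-label≢ e e-inj ℓ j)

      decode-isForest : ∀ s (e : Fin (suc s) → Fin M) → Injective _≡_ _≡_ e → (c : Code M s) →
        All (Among e) c → IsForestOn e (decode s e c)
      decode-isForest zero e _ [] [] = forest (λ _ → inj₁ refl) (λ _ → up root)
      decode-isForest (suc s) e e-inj (x ∷ c) (ax ∷ ac) = forest among reach
        where
          open DecodeStep e e-inj x c
          F′ : IsForestOn e′ (decode s e′ c)
          F′ = decode-isForest s e′ e′-inj c (all-among′ ac)
          f : ParentMap M
          f = decode (suc s) e (x ∷ c)
          x-among : Among e′ x
          x-among = among-punchIn⁻ e ℓ ax x≢ℓ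
          among : ∀ i → Among e (f (e i))
          among i with ≡⊎punchIn ℓ i
          ... | inj₁ refl = subst (Among e) (sym (override-same (e ℓ) x (decode s e′ c))) ax
          ... | inj₂ (j , refl) = subst (Among e) (sym (decode-punchIn j)) (among-punchIn⁺ e ℓ (parent-among F′ j))
          reach : ∀ i → ReachesRoot f (just (e i))
          reach i with ≡⊎punchIn ℓ i
          ... | inj₁ refl = up (subst (ReachesRoot f) (sym (override-same (e ℓ) x (decode s e′ c)))
                (reachesRoot-transfer e′ decode-punchIn (parent-among F′) x-among
                  (among⇒reachesRoot e′ (reaches-root F′) x-among)))
          ... | inj₂ (j , refl) =
                reachesRoot-transfer e′ decode-punchIn (parent-among F′) (inj₂ (j , refl)) (reaches-root F′ j)

      hasChild-decode : ∀ s (e : Fin (suc s) → Fin M) → Injective _≡_ _≡_ e → (c : Code M s) →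
        All (Among e) c → ∀ i → hasChildᵇ (decode s e c) e i ≡ occursᵇ (e i) c
      hasChild-decode zero e _ [] [] zero = refl
      hasChild-decode (suc s) e e-inj (x ∷ c) (ax ∷ ac) i =
        trans (anyᵇ-punchIn (λ j → decode (suc s) e (x ∷ c) (e j) == just (e i)) ℓ)
          (cong₂ _∨_ (cong (_== just (e i)) (override-same (e ℓ) x (decode s e′ c)))
            (trans (anyᵇ-cong λ j → cong (_== just (e i)) (decode-punchIn j)) rest))
        where
          open DecodeStep e e-inj x c
          rest : anyᵇ (λ j → decode s e′ c (e′ j) == just (e i)) ≡ occursᵇ (e i) c
          rest with ≡⊎punchIn ℓ i
          ... | inj₁ refl = trans (anyᵇ-false⁺ _ λ j → among-punchIn⇒≢ e e-inj ℓ
                  (parent-among (decode-isForest s e′ e′-inj c (all-among′ ac)) j))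
                (sym (∨-conicalʳ _ _ ℓ-absent))
          ... | inj₂ (i′ , refl) = hasChild-decode s e′ e′-inj c (all-among′ ac) i′

      decode-encode : ∀ s (e : Fin (suc s) → Fin M) {f} → Injective _≡_ _≡_ e → IsForestOn e f →
        ∀ i → decode s e (encode s e f) (e i) ≡ f (e i)
      decode-encode zero e _ (forest among reach) zero with among zero
      ... | inj₁ p = sym p
      ... | inj₂ (zero , p) = contradiction p (reachesRoot⇒noFixedPoint (reach zero) refl)
      decode-encode (suc s) e {f} e-inj F i = trans (decode-step e (f (e ℓ)) _ absent≡ℓ (e i)) rest
        where
          open LeafRemoval e e-inj F
          absent≡ℓ : absent e (encode (suc s) e f) ≡ ℓ
          absent≡ℓ = first-cong λ j → cong not (occurs-encode (suc s) e e-inj F j)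
          rest : override (e ℓ) (f (e ℓ)) (decode s e′ (encode s e′ f)) (e i) ≡ f (e i)
          rest with ≡⊎punchIn ℓ i
          ... | inj₁ refl = override-same (e ℓ) (f (e ℓ)) (decode s e′ (encode s e′ f))
          ... | inj₂ (j , refl) = trans (override-other (e ℓ) (f (e ℓ)) (decode s e′ (encode s e′ f)) (punchIn-label≢ e e-inj ℓ j))
                (decode-encode s e′ e′-inj F′ j)

      encode-decode : ∀ s (e : Fin (suc s) → Fin M) → Injective _≡_ _≡_ e → (c : Code M s) →
        All (Among e) c → encode s e (decode s e c) ≡ c
      encode-decode zero e _ [] [] = refl
      encode-decode (suc s) e e-inj (x ∷ c) (ax ∷ ac) =
        trans (encode-step e leaf≡ℓ) (cong₂ _∷_ (override-same (e ℓ) x (decode s e′ c))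
          (trans (encode-cong s e′ decode-punchIn) (encode-decode s e′ e′-inj c (all-among′ ac))))
        where
          open DecodeStep e e-inj x c
          leaf≡ℓ : leaf (decode (suc s) e (x ∷ c)) e ≡ ℓ
          leaf≡ℓ = first-cong λ j → cong not (hasChild-decode (suc s) e e-inj (x ∷ c) (ax ∷ ac) j)

  module Cayley where

    open Prüfer

    pointwise-inverse : ∀ {a ℓ b r} {S : Setoid a ℓ} {T : Setoid b r} n →
      Inverse S T → Inverse (≋-setoid S n) (≋-setoid T n)
    pointwise-inverse n φ = record
      { to = λ f i → to (f i)
      ; from = λ f i → from (f i)
      ; to-cong = λ p i → to-cong (p i)
      ; from-cong = λ p i → from-cong (p i)
      ; inverse = (λ p i → inverseˡ (p i)) , (λ p i → inverseʳ (p i)) }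
      where open Inverse φ

    funToFin-cong : ∀ {m n} {f g : Fin m → Fin n} → f ≗ g → funToFin f ≡ funToFin g
    funToFin-cong {zero} h = refl
    funToFin-cong {suc m} h = cong₂ combine (h zero) (funToFin-cong (h ∘ suc))

    Fin^↔Fun : ∀ k n → Inverse (≡.setoid (Fin (k ^ n))) (≋-setoid (≡.setoid (Fin k)) n)
    Fin^↔Fun k n = record
      { to = finToFun
      ; from = funToFin
      ; to-cong = λ { refl i → refl }
      ; from-cong = funToFin-cong
      ; inverse = (λ {f} p i → trans (cong (λ y → finToFun y i) p) (finToFun-funToFin f i))
                , (λ {x} p → trans (funToFin-cong p) (funToFin-finToFin {n} {k} x)) }

    toFin : ∀ {m} → Maybe (Fin m) → Fin (suc m)
    toFin nothing = zero
    toFin (just i) = suc i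

    fromFin : ∀ {m} → Fin (suc m) → Maybe (Fin m)
    fromFin zero = nothing
    fromFin (suc i) = just i

    Fun↔Code : ∀ m s → Inverse (≋-setoid (≡.setoid (Fin (suc m))) s) (≡.setoid (Code m s))
    Fun↔Code m s = record
      { to = λ g → tabulate (fromFin ∘ g)
      ; from = λ c i → toFin (lookup c i)
      ; to-cong = λ p → tabulate-cong (cong fromFin ∘ p)
      ; from-cong = λ { refl i → refl }
      ; inverse = (λ {c} p → trans (tabulate-cong (cong fromFin ∘ p))
                     (trans (tabulate-cong (fromFin-toFin ∘ lookup c)) (tabulate∘lookup c)))
                , (λ {g} p i → trans (cong (λ v → toFin (lookup v i)) p)
                     (trans (cong toFin (lookup∘tabulate (fromFin ∘ g) i)) (toFin-fromFin (g i)))) }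
      where
        toFin-fromFin : ∀ i → toFin (fromFin {m} i) ≡ i
        toFin-fromFin zero = refl
        toFin-fromFin (suc i) = refl
        fromFin-toFin : ∀ x → fromFin (toFin {m} x) ≡ x
        fromFin-toFin nothing = refl
        fromFin-toFin (just i) = refl

    RootedForest : ℕ → Set
    RootedForest m = Σ (ParentMap m) λ f → ∀ a → ReachesRoot f (just a)

    RootedForestSetoid : ℕ → Setoid 0ℓ 0ℓ
    RootedForestSetoid m = On.setoid {B = RootedForest m} (≋-setoid (≡.setoid (Maybe (Fin m))) m) proj₁

    -- the identity labels the whole vertex set, so every code is admissible
    Code↔RootedForest : ∀ s → Inverse (≡.setoid (Code (suc s) s)) (RootedForestSetoid (suc s))
    Code↔RootedForest s = record
      { to = λ c → decode s id c , reaches-root (decode-isForest s id id c (all-among c))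
      ; from = λ F → encode s id (proj₁ F)
      ; to-cong = λ { refl a → refl }
      ; from-cong = encode-cong s id
      ; inverse = (λ {F} p a → trans (cong (λ v → decode s id v a) p)
                     (decode-encode s id id (forest (λ _ → among-id _) (proj₂ F)) a))
                , (λ {c} p → trans (encode-cong s id p) (encode-decode s id id c (all-among c))) }
      where
        among-id : ∀ x → Among id x
        among-id nothing = inj₁ refl
        among-id (just j) = inj₂ (j , refl)
        all-among : ∀ {k} (c : Code (suc s) k) → All (Among id) c
        all-among = universal among-id

    cayley : ∀ s → Inverse (≡.setoid (Fin (suc (suc s) ^ s))) (RootedForestSetoid (suc s))
    cayley s = Comp.inverse (Fin^↔Fun (suc (suc s)) s) (Comp.inverse (Fun↔Code (suc s) s) (Code↔RootedForest s))

module GraphPaths where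

  open import Data.Nat as ℕ using (ℕ; zero; suc; _≤_)
  open import Data.Nat.Properties using (≤-refl; ≤-trans; ≤-total; m≢1+n+m)
  open import Data.Fin using (Fin; zero; suc; inject₁; fromℕ; toℕ)
  open import Data.Fin.Properties using (toℕ-inject₁)
  open import Data.Bool using (Bool; true)
  open import Data.List using (List; []; _∷_; _++_; length; lookup; [_])
  open import Data.List.Relation.Unary.Any using (here; there)
  open import Data.List.Membership.Propositional using (_∈_; _∉_)
  open import Data.List.Membership.Propositional.Properties using (∈-++⁻; ∈-lookup)
  open import Data.List.Relation.Binary.Subset.Propositional using (_⊆_)
  import Data.List.Membership.DecPropositional as DecMembership
  open import Data.Product using (∃; _×_; _,_)
  open import Data.Sum using (_⊎_; inj₁; inj₂)
  open import Data.Unit using (⊤; tt)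
  open import Data.Empty using (⊥)
  open import Relation.Nullary using (¬_; yes; no; contradiction)
  open import Relation.Binary using (DecidableEquality)
  open import Relation.Binary.PropositionalEquality as ≡ using (_≡_; _≢_; refl; sym; trans; cong; subst)
  open import Function using (_∘_)
  open import Defs using (Walk; here; step; HasCycle)

  module Paths {V : Set} where

    end : V → List V → V
    end a [] = a
    end a (x ∷ xs) = end x xs

    end∈ : ∀ a xs → end a xs ∈ a ∷ xs
    end∈ a [] = here refl
    end∈ a (x ∷ xs) = there (end∈ x xs)

    end-++ : ∀ a xs ys → end a (xs ++ ys) ≡ end (end a xs) ys
    end-++ a [] ys = refl
    end-++ a (x ∷ xs) ys = end-++ x xs ys

    Distinct : List V → Set
    Distinct [] = ⊤
    Distinct (x ∷ xs) = x ∉ xs × Distinct xs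

    lookup-injective : ∀ xs → Distinct xs → ∀ i j → lookup xs i ≡ lookup xs j → i ≡ j
    lookup-injective (x ∷ xs) d zero zero p = refl
    lookup-injective (x ∷ xs) (x∉ , d) zero (suc j) p = contradiction (subst (_∈ xs) (sym p) (∈-lookup j)) x∉
    lookup-injective (x ∷ xs) (x∉ , d) (suc i) zero p = contradiction (subst (_∈ xs) p (∈-lookup i)) x∉
    lookup-injective (x ∷ xs) (x∉ , d) (suc i) (suc j) p = cong suc (lookup-injective xs d i j p)

    Path : (V → V → Bool) → V → List V → Set
    Path E a [] = ⊤
    Path E a (x ∷ xs) = E a x ≡ true × Path E x xs

    module _ {E : V → V → Bool} where

      path-resp : ∀ {E′} → (∀ u w → E′ u w ≡ E u w) → ∀ {a} xs → Path E′ a xs → Path E a xs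
      path-resp E′≡E [] p = tt
      path-resp E′≡E {a} (x ∷ xs) (e , p) = trans (sym (E′≡E a x)) e , path-resp E′≡E xs p

      path-++ : ∀ a xs ys → Path E a xs → Path E (end a xs) ys → Path E a (xs ++ ys)
      path-++ a [] ys p q = q
      path-++ a (x ∷ xs) ys (e , p) q = e , path-++ x xs ys p q

      walk⇒path : ∀ {u v} → Walk (≡.setoid V) E u v → ∃ λ xs → Path E u xs × end u xs ≡ v
      walk⇒path (here p) = [] , tt , p
      walk⇒path (step {w = w} e wk) = let (xs , p , l) = walk⇒path wk in w ∷ xs , (e , p) , l

      path⇒walk : ∀ u xs → Path E u xs → Walk (≡.setoid V) E u (end u xs)
      path⇒walk u [] p = here refl
      path⇒walk u (x ∷ xs) (e , p) = step e (path⇒walk x xs p)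

      path-lookup : ∀ a ys → Path E a ys → ∀ (i : Fin (length ys)) →
        E (lookup (a ∷ ys) (inject₁ i)) (lookup (a ∷ ys) (suc i)) ≡ true
      path-lookup a (y ∷ ys) (e , p) zero = e
      path-lookup a (y ∷ ys) (e , p) (suc i) = path-lookup y ys p i

      lookup-end : ∀ a ys → lookup (a ∷ ys) (fromℕ (length ys)) ≡ end a ys
      lookup-end a [] = refl
      lookup-end a (y ∷ ys) = lookup-end y ys

      closedPath⇒cycle : ∀ a x₁ x₂ xs → Distinct (a ∷ x₁ ∷ x₂ ∷ xs) → Path E a (x₁ ∷ x₂ ∷ xs) →
        E (end x₂ xs) a ≡ true → HasCycle (≡.setoid V) E
      closedPath⇒cycle a x₁ x₂ xs d p closing =
        length xs , lookup (a ∷ x₁ ∷ x₂ ∷ xs) ,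
        lookup-injective (a ∷ x₁ ∷ x₂ ∷ xs) d ,
        path-lookup a (x₁ ∷ x₂ ∷ xs) p ,
        subst (λ w → E w a ≡ true) (sym (lookup-end a (x₁ ∷ x₂ ∷ xs))) closing

  module LoopErasure {V : Set} (_≟_ : DecidableEquality V) (E : V → V → Bool) where

    open Paths
    open DecMembership _≟_ using (_∈?_)

    dropThrough : V → List V → List V
    dropThrough a [] = []
    dropThrough a (y ∷ ys) with y ≟ a
    ... | yes _ = ys
    ... | no _ = dropThrough a ys

    dropThrough-path : ∀ a b ys → Path E b ys → Distinct ys → a ∈ ys →
      Path E a (dropThrough a ys) × Distinct (a ∷ dropThrough a ys) ×
      end a (dropThrough a ys) ≡ end b ys × dropThrough a ys ⊆ ys
    dropThrough-path a b (y ∷ ys) (e , p) (y∉ , d) a∈ with y ≟ a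
    ... | yes refl = p , (y∉ , d) , refl , there
    ... | no y≢a with a∈
    ...   | here a≡y = contradiction (sym a≡y) y≢a
    ...   | there a∈ys = let (p′ , d′ , l′ , s′) = dropThrough-path a y ys p d a∈ys in p′ , d′ , l′ , there ∘ s′

    eraseLoops : V → List V → List V
    eraseLoops a [] = []
    eraseLoops a (x ∷ xs) with a ∈? (x ∷ eraseLoops x xs)
    ... | yes _ = dropThrough a (x ∷ eraseLoops x xs)
    ... | no _ = x ∷ eraseLoops x xs

    eraseLoops-path : ∀ a xs → Path E a xs →
      Path E a (eraseLoops a xs) × Distinct (a ∷ eraseLoops a xs) × end a (eraseLoops a xs) ≡ end a xs ×
      eraseLoops a xs ⊆ xs
    eraseLoops-path a [] p = tt , ((λ ()) , tt) , refl , λ ()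
    eraseLoops-path a (x ∷ xs) (e , p) with eraseLoops-path x xs p
    ... | (p′ , d′ , l′ , s′) with a ∈? (x ∷ eraseLoops x xs)
    ...   | yes a∈ = let (p″ , d″ , l″ , s″) = dropThrough-path a a (x ∷ eraseLoops x xs) (e , p′) d′ a∈
                     in p″ , d″ , trans l″ l′ , cons⊆ ∘ s″
      where
        cons⊆ : x ∷ eraseLoops x xs ⊆ x ∷ xs
        cons⊆ (here q) = here q
        cons⊆ (there q) = there (s′ q)
    ...   | no a∉ = (e , p′) , (a∉ , d′) , l′ , cons⊆
      where
        cons⊆ : x ∷ eraseLoops x xs ⊆ x ∷ xs
        cons⊆ (here q) = here q
        cons⊆ (there q) = there (s′ q)

    takeThrough : V → List V → List V
    takeThrough u [] = []
    takeThrough u (y ∷ ys) with y ≟ u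
    ... | yes _ = y ∷ []
    ... | no _ = y ∷ takeThrough u ys

    takeThrough-path : ∀ u b ys → Path E b ys → Distinct ys → u ∈ ys →
      Path E b (takeThrough u ys) × Distinct (takeThrough u ys) × end b (takeThrough u ys) ≡ u ×
      takeThrough u ys ⊆ ys
    takeThrough-path u b (y ∷ ys) (e , p) (y∉ , d) u∈ with y ≟ u
    ... | yes y≡u = (e , tt) , ((λ ()) , tt) , y≡u , λ { (here q) → here q }
    ... | no y≢u with u∈
    ...   | here u≡y = contradiction (sym u≡y) y≢u
    ...   | there u∈ys = let (p′ , d′ , l′ , s′) = takeThrough-path u y ys p d u∈ys in
                         (e , p′) , ((λ q → y∉ (s′ q)) , d′) , l′ , λ { (here q) → here q ; (there q) → there (s′ q) }

  module UndirectedGraph {V : Set} (_≟_ : DecidableEquality V) (E : V → V → Bool)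
                         (E-sym : ∀ u v → E u v ≡ E v u) where

    open Paths
    open LoopErasure _≟_ E

    reversePath : V → List V → List V
    reversePath y [] = []
    reversePath y (q ∷ qs) = reversePath q qs ++ [ y ]

    end-reversePath : ∀ y qs → end (end y qs) (reversePath y qs) ≡ y
    end-reversePath y [] = refl
    end-reversePath y (q ∷ qs) = end-++ (end q qs) (reversePath q qs) [ y ]

    path-reversePath : ∀ y qs → Path E y qs → Path E (end y qs) (reversePath y qs)
    path-reversePath y [] p = tt
    path-reversePath y (q ∷ qs) (e , p) =
      path-++ (end q qs) (reversePath q qs) [ y ] (path-reversePath q qs p)
        (subst (λ w → Path E w [ y ]) (sym (end-reversePath q qs)) (trans (E-sym q y) e , tt))

    reversePath⊆ : ∀ y qs → reversePath y qs ⊆ y ∷ qs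
    reversePath⊆ y (q ∷ qs) r with ∈-++⁻ (reversePath q qs) r
    ... | inj₁ r′ = there (reversePath⊆ q qs r′)
    ... | inj₂ (here r′) = here r′

    path-join : ∀ a b xs ys → Path E a xs → Path E b ys → end a xs ≡ end b ys →
      Path E a (xs ++ reversePath b ys) × end a (xs ++ reversePath b ys) ≡ b
    path-join a b xs ys p q ends =
      path-++ a xs (reversePath b ys) p (subst (λ z → Path E z (reversePath b ys)) (sym ends) (path-reversePath b ys q)) ,
      trans (end-++ a xs (reversePath b ys)) (trans (cong (λ z → end z (reversePath b ys)) ends) (end-reversePath b ys))

    private
      lastOrInject₁ : ∀ {n} (j : Fin (suc n)) → j ≡ fromℕ n ⊎ ∃ λ j′ → j ≡ inject₁ j′
      lastOrInject₁ {zero} zero = inj₁ refl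
      lastOrInject₁ {suc n} zero = inj₂ (zero , refl)
      lastOrInject₁ {suc n} (suc j) with lastOrInject₁ j
      ... | inj₁ p = inj₁ (cong suc p)
      ... | inj₂ (j′ , p) = inj₂ (suc j′ , cong suc p)

      suc-suc≢inject₁-inject₁ : ∀ {n} (j : Fin n) → suc (suc j) ≢ inject₁ (inject₁ j)
      suc-suc≢inject₁-inject₁ j p =
        m≢1+n+m _ (sym (trans (cong toℕ p) (trans (toℕ-inject₁ _) (toℕ-inject₁ j))))

    cycle-neighbours : ∀ k (cyc : Fin (3 ℕ.+ k) → V) →
      (∀ (i : Fin (2 ℕ.+ k)) → E (cyc (inject₁ i)) (cyc (suc i)) ≡ true) →
      E (cyc (fromℕ (2 ℕ.+ k))) (cyc zero) ≡ true →
      ∀ i → ∃ λ j₁ → ∃ λ j₂ → j₁ ≢ j₂ × E (cyc i) (cyc j₁) ≡ true × E (cyc i) (cyc j₂) ≡ true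
    cycle-neighbours k cyc edge closing zero = suc zero , fromℕ (2 ℕ.+ k) , (λ ()) , edge zero , trans (E-sym _ _) closing
    cycle-neighbours k cyc edge closing (suc j) with lastOrInject₁ j
    ... | inj₁ refl = inject₁ j , zero , (λ ()) , trans (E-sym _ _) (edge j) , closing
    ... | inj₂ (j′ , refl) = inject₁ (inject₁ j′) , suc (suc j′) , suc-suc≢inject₁-inject₁ j′ ∘ sym ,
                             trans (E-sym _ _) (edge (inject₁ j′)) , edge (suc j′)

    module Acyclic (acyclic : ¬ HasCycle (≡.setoid V) E) where

      simplePath-unique : ∀ a ps qs → Path E a ps → Path E a qs → Distinct (a ∷ ps) → Distinct (a ∷ qs) →
        end a ps ≡ end a qs → ps ≡ qs
      simplePath-unique a [] [] _ _ _ _ _ = refl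
      simplePath-unique a [] (y ∷ qs) _ _ _ (a∉ , _) l = contradiction (subst (_∈ y ∷ qs) (sym l) (end∈ y qs)) a∉
      simplePath-unique a (x ∷ ps) [] _ _ (a∉ , _) _ l = contradiction (subst (_∈ x ∷ ps) l (end∈ x ps)) a∉
      simplePath-unique a (x ∷ ps) (y ∷ qs) (e , p) (e′ , q) (a∉ps , d) (a∉qs , d′) l with x ≟ y
      ... | yes refl = cong (x ∷_) (simplePath-unique x ps qs p q d d′ l)
      ... | no x≢y with path-join x y ps qs p q l
      ...   | pw , w↝y = closeCycle (eraseLoops x w) (eraseLoops-path x w pw)
        where
          w : List V
          w = ps ++ reversePath y qs
          a∉w : a ∉ w
          a∉w m with ∈-++⁻ ps m
          ... | inj₁ m′ = a∉ps (there m′)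
          ... | inj₂ m′ = a∉qs (reversePath⊆ y qs m′)
          closeCycle : ∀ r → Path E x r × Distinct (x ∷ r) × end x r ≡ end x w × r ⊆ w → x ∷ ps ≡ y ∷ qs
          closeCycle [] (_ , _ , l′ , _) = contradiction (trans l′ w↝y) x≢y
          closeCycle (z ∷ r) (pr , dr , l′ , r⊆w) = contradiction
            (closedPath⇒cycle a x z r (a∉ , dr) (e , pr)
              (subst (λ t → E t a ≡ true) (sym (trans l′ w↝y)) (trans (E-sym y a) e′)))
            acyclic
            where
              a∉ : a ∉ x ∷ z ∷ r
              a∉ (here p) = a∉ps (here p)
              a∉ (there m) = a∉w (r⊆w m)

      noChord : ∀ v s rest u → Path E v (s ∷ rest) → Distinct (v ∷ s ∷ rest) → u ∈ rest → E u v ≡ true → ⊥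
      noChord v s rest u (e , p) (v∉ , (s∉ , d)) u∈ closing = go (takeThrough u rest) (takeThrough-path u s rest p d u∈)
        where
          go : ∀ r → Path E s r × Distinct r × end s r ≡ u × r ⊆ rest → ⊥
          go [] (_ , _ , l , _) = s∉ (subst (_∈ rest) (sym l) u∈)
          go (x ∷ r) (pr , dr , l , r⊆) = acyclic (closedPath⇒cycle v s x r (v∉′ , (s∉ ∘ r⊆) , dr) (e , pr)
                                                    (subst (λ t → E t v ≡ true) (sym l) closing))
            where
              v∉′ : v ∉ s ∷ x ∷ r
              v∉′ (here q) = v∉ (here q)
              v∉′ (there q) = v∉ (there (r⊆ q))

  argmax : ∀ {n} (g : Fin (suc n) → ℕ) → ∃ λ i → ∀ j → g j ≤ g i
  argmax {zero} g = zero , λ { zero → ≤-refl }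
  argmax {suc n} g with argmax (g ∘ suc)
  ... | (i , h) with ≤-total (g zero) (g (suc i))
  ...   | inj₁ g0≤ = suc i , λ { zero → g0≤ ; (suc j) → h j }
  ...   | inj₂ g0≥ = zero , λ { zero → ≤-refl ; (suc j) → ≤-trans (h j) g0≥ }

module Windmills where

  open import Data.Nat using (ℕ; zero; suc; _≤_; _<_)
  open import Data.Nat.Properties using (≤-reflexive; <-irrefl; <-trans; ≤-trans)
  open import Data.Fin using (Fin)
  import Data.Fin.Properties as Fin
  open import Data.Maybe using (Maybe; just; nothing)
  open import Data.Maybe.Properties using () renaming (≡-dec to ≡-decᴹ)
  open import Data.Product.Properties using () renaming (≡-dec to ≡-decˣ)
  open import Data.Bool using (Bool; true; false; _∨_)
  open import Data.Bool.Properties using (∨-comm; ∨-zeroʳ)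
  open import Data.List using (List; []; _∷_)
  open import Data.List.Relation.Unary.Any using (here; there)
  open import Data.List.Membership.Propositional using (_∈_; _∉_)
  import Data.List.Membership.DecPropositional as DecMembership
  open import Data.Vec.Functional.Relation.Binary.Equality.Setoid using (≋-setoid)
  open import Data.Product using (∃; _×_; _,_; proj₁; proj₂)
  open import Data.Sum using (_⊎_; inj₁; inj₂)
  open import Data.Unit using (⊤; tt)
  open import Data.Empty using (⊥)
  open import Relation.Nullary using (¬_; yes; no; contradiction)
  open import Relation.Binary using (Setoid; DecidableEquality)
  open import Relation.Binary.PropositionalEquality as ≡ using (_≡_; _≢_; refl; sym; trans; cong; cong₂; subst)
  open import Function using (_∘_)
  open import Function.Bundles using (Inverse)
  open import Defs using (Walk; HasCycle; SpanningTree; SpanningTreeSetoid)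
  open CayleyFormula using (module BoolEquality; module Prüfer; module Cayley)
  open GraphPaths

  open Prüfer using (ParentMap; ReachesRoot; root; up; reachesRoot⇒noFixedPoint)
  open Cayley using (RootedForestSetoid)

  module _ {M : ℕ} {f : ParentMap M} where

    height : ∀ {x} → ReachesRoot f x → ℕ
    height root = zero
    height (up r) = suc (height r)

    reachesRoot-irrelevant : ∀ {x} (r r′ : ReachesRoot f x) → r ≡ r′
    reachesRoot-irrelevant root root = refl
    reachesRoot-irrelevant (up r) (up r′) = cong up (reachesRoot-irrelevant r r′)

  module Windmill (L m : ℕ) where

    -- nothing is the hub; just (l , a) is vertex a of blade l, and the blades are the cliques Kₘ₊₁
    Vertex : Set
    Vertex = Maybe (Fin L × Fin m)

    _≟ᵛ_ : DecidableEquality Vertex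
    _≟ᵛ_ = ≡-decᴹ (≡-decˣ Fin._≟_ Fin._≟_)

    open BoolEquality _≟ᵛ_
    open Paths

    Adjacent : Vertex → Vertex → Set
    Adjacent nothing nothing = ⊥
    Adjacent nothing (just _) = ⊤
    Adjacent (just _) nothing = ⊤
    Adjacent (just (l , a)) (just (l′ , b)) = l ≡ l′ × a ≢ b

    adjacent-sym : ∀ u v → Adjacent u v → Adjacent v u
    adjacent-sym nothing (just _) _ = tt
    adjacent-sym (just _) nothing _ = tt
    adjacent-sym (just (l , a)) (just (l′ , b)) (l≡l′ , a≢b) = sym l≡l′ , a≢b ∘ sym

    adjacent-irrefl : ∀ u → ¬ Adjacent u u
    adjacent-irrefl (just (l , a)) (_ , a≢a) = a≢a refl

    ForestFamilies : Setoid _ _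
    ForestFamilies = ≋-setoid (RootedForestSetoid m) L

    ForestFamily : Set
    ForestFamily = Setoid.Carrier ForestFamilies

    lift : Fin L → Maybe (Fin m) → Vertex
    lift l nothing = nothing
    lift l (just b) = just (l , b)

    local : Vertex → Maybe (Fin m)
    local nothing = nothing
    local (just (_ , b)) = just b

    local-lift : ∀ l x → local (lift l x) ≡ x
    local-lift l nothing = refl
    local-lift l (just b) = refl

    lift-local : ∀ l a w → Adjacent (just (l , a)) w → lift l (local w) ≡ w
    lift-local l a nothing _ = refl
    lift-local l a (just (.l , b)) (refl , _) = refl

    headOrHub : List Vertex → Vertex
    headOrHub [] = nothing
    headOrHub (x ∷ _) = x

    module FromForests (P : ForestFamily) where

      parentMap : Fin L → ParentMap m
      parentMap l = proj₁ (P l)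

      parent : Vertex → Vertex
      parent nothing = nothing
      parent (just (l , a)) = lift l (parentMap l a)

      upEdge : Vertex → Vertex → Bool
      upEdge nothing v = false
      upEdge (just x) v = parent (just x) == v

      edge : Vertex → Vertex → Bool
      edge u v = upEdge u v ∨ upEdge v u

      edge-sym : ∀ u v → edge u v ≡ edge v u
      edge-sym u v = ∨-comm (upEdge u v) (upEdge v u)

      upEdge⇒parent : ∀ u v → upEdge u v ≡ true → u ≢ nothing × v ≡ parent u
      upEdge⇒parent (just x) v e = (λ ()) , sym (==⇒≡ _ v e)

      parent⇒upEdge : ∀ u v → u ≢ nothing → parent u ≡ v → upEdge u v ≡ true
      parent⇒upEdge nothing v u≢hub _ = contradiction refl u≢hub
      parent⇒upEdge (just x) v u≢hub refl = ==-refl (parent (just x))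

      edge-parent : ∀ u → u ≢ nothing → edge u (parent u) ≡ true
      edge-parent u u≢hub rewrite parent⇒upEdge u (parent u) u≢hub refl = refl

      upEdge⇒adjacent : ∀ u v → upEdge u v ≡ true → Adjacent u v
      upEdge⇒adjacent (just (l , a)) v e with ==⇒≡ (parent (just (l , a))) v e
      ... | refl with parentMap l a in eq
      ...   | nothing = tt
      ...   | just b = refl , λ { refl → reachesRoot⇒noFixedPoint (proj₂ (P l) a) refl eq }

      edge⇒adjacent : ∀ u v → edge u v ≡ true → Adjacent u v
      edge⇒adjacent u v e with upEdge u v in e₁
      ... | true = upEdge⇒adjacent u v e₁
      ... | false = adjacent-sym v u (upEdge⇒adjacent v u e)

      depth : Vertex → ℕ
      depth nothing = zero
      depth (just (l , a)) = height (proj₂ (P l) a)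

      depth-lift : ∀ l x (r : ReachesRoot (parentMap l) x) → depth (lift l x) ≡ height r
      depth-lift l nothing root = refl
      depth-lift l (just b) r = cong height (reachesRoot-irrelevant (proj₂ (P l) b) r)

      depth-parent : ∀ u → u ≢ nothing → depth u ≡ suc (depth (parent u))
      depth-parent nothing u≢hub = contradiction refl u≢hub
      depth-parent (just (l , a)) _ with proj₂ (P l) a
      ... | up r = cong suc (sym (depth-lift l (parentMap l a) r))

      edge⇒parent : ∀ x y → edge x y ≡ true → depth y ≤ depth x → y ≡ parent x
      edge⇒parent x y e y≤x with upEdge x y in e₁
      ... | true = proj₂ (upEdge⇒parent x y e₁)
      ... | false with upEdge⇒parent y x e
      ...   | y≢hub , refl = contradiction (≤-trans (≤-reflexive (sym (depth-parent y y≢hub))) y≤x) (<-irrefl refl)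

      pathToHub-lift : ∀ l {x} (r : ReachesRoot (parentMap l) x) →
        ∃ λ xs → Path edge (lift l x) xs × end (lift l x) xs ≡ nothing
      pathToHub-lift l root = [] , tt , refl
      pathToHub-lift l (up {a} r) = let (xs , p , e) = pathToHub-lift l r in
        lift l (parentMap l a) ∷ xs , (edge-parent (just (l , a)) (λ ()) , p) , e

      pathToHub : ∀ u → ∃ λ xs → Path edge u xs × end u xs ≡ nothing
      pathToHub nothing = [] , tt , refl
      pathToHub (just (l , a)) = pathToHub-lift l (proj₂ (P l) a)

      open UndirectedGraph _≟ᵛ_ edge edge-sym

      connected : ∀ u v → Walk (≡.setoid Vertex) edge u v
      connected u v with pathToHub u | pathToHub v
      ... | xs , p , u↝hub | ys , q , v↝hub with path-join u v xs ys p q (trans u↝hub (sym v↝hub))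
      ...   | pq , ends = subst (Walk (≡.setoid Vertex) edge u) ends (path⇒walk u _ pq)

      -- the deepest vertex of a cycle would have two distinct parents
      acyclic : ¬ HasCycle (≡.setoid Vertex) edge
      acyclic (k , cyc , cyc-inj , edges , closing) with argmax (depth ∘ cyc)
      ... | i , deepest with cycle-neighbours k cyc edges closing i
      ...   | j₁ , j₂ , j₁≢j₂ , e₁ , e₂ = j₁≢j₂ (cyc-inj j₁ j₂
              (trans (edge⇒parent (cyc i) (cyc j₁) e₁ (deepest j₁)) (sym (edge⇒parent (cyc i) (cyc j₂) e₂ (deepest j₂)))))

      tree : SpanningTree (≡.setoid Vertex) Adjacent
      tree = record
        { E = edge
        ; E-resp = λ { refl refl → refl }
        ; E-sym = edge-sym
        ; E⊆Adj = edge⇒adjacent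
        ; connected = connected
        ; acyclic = acyclic }

    module FromTree (T : SpanningTree (≡.setoid Vertex) Adjacent) where

      open SpanningTree T
      open UndirectedGraph _≟ᵛ_ E E-sym
      open Acyclic acyclic
      open LoopErasure _≟ᵛ_ E
      open DecMembership _≟ᵛ_ using (_∈?_)

      SimplePathToHub : Vertex → List Vertex → Set
      SimplePathToHub v xs = Path E v xs × Distinct (v ∷ xs) × end v xs ≡ nothing

      pathToHub : Vertex → List Vertex
      pathToHub v = eraseLoops v (proj₁ (walk⇒path (connected v nothing)))

      pathToHub-simple : ∀ v → SimplePathToHub v (pathToHub v)
      pathToHub-simple v with walk⇒path (connected v nothing)
      ... | xs , p , l with eraseLoops-path v xs p
      ...   | p′ , d′ , l′ , _ = p′ , d′ , trans l′ l

      pathToHub-unique : ∀ v {ys} → SimplePathToHub v ys → pathToHub v ≡ ys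
      pathToHub-unique v {ys} (p , d , l) = let (p′ , d′ , l′) = pathToHub-simple v in
        simplePath-unique v (pathToHub v) ys p′ p d′ d (trans l′ (sym l))

      pathToHub≡⇒simple : ∀ v {xs} → pathToHub v ≡ xs → SimplePathToHub v xs
      pathToHub≡⇒simple v refl = pathToHub-simple v

      pathToHub-nonempty : ∀ v → v ≢ nothing → ∃ λ w → ∃ λ rest → pathToHub v ≡ w ∷ rest
      pathToHub-nonempty v v≢hub with pathToHub v in eq
      ... | [] = contradiction (proj₂ (proj₂ (pathToHub≡⇒simple v eq))) v≢hub
      ... | w ∷ rest = w , rest , refl

      pathToHub-nonempty⇒≢hub : ∀ v {w rest} → pathToHub v ≡ w ∷ rest → v ≢ nothing
      pathToHub-nonempty⇒≢hub v {w} {rest} eq refl with pathToHub≡⇒simple nothing eq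
      ... | _ , (hub∉ , _) , l = hub∉ (subst (_∈ w ∷ rest) l (end∈ w rest))

      parentOf : Vertex → Vertex
      parentOf v = headOrHub (pathToHub v)

      localParent : Fin L → ParentMap m
      localParent l a = local (parentOf (just (l , a)))

      localParent-reachesRoot : ∀ xs l a → pathToHub (just (l , a)) ≡ xs → ReachesRoot (localParent l) (just a)
      localParent-reachesRoot [] l a eq = contradiction (proj₂ (proj₂ (pathToHub≡⇒simple (just (l , a)) eq))) λ ()
      localParent-reachesRoot (w ∷ rest) l a eq with pathToHub≡⇒simple (just (l , a)) eq
      ... | (e , p) , (_ , d) , end≡hub =
        up (subst (ReachesRoot (localParent l)) (sym (cong (local ∘ headOrHub) eq)) (continue w (E⊆Adj _ _ e) p d end≡hub))
        where
          continue : ∀ w → Adjacent (just (l , a)) w → Path E w rest → Distinct (w ∷ rest) → end w rest ≡ nothing →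
            ReachesRoot (localParent l) (local w)
          continue nothing _ _ _ _ = root
          continue (just (.l , b)) (refl , _) p d end≡hub =
            localParent-reachesRoot rest l b (pathToHub-unique (just (l , b)) (p , d , end≡hub))

      forests : ForestFamily
      forests l = localParent l , λ a → localParent-reachesRoot _ l a refl

      module Forests = FromForests forests

      edge-parentOf : ∀ u → u ≢ nothing → E u (parentOf u) ≡ true
      edge-parentOf u u≢hub with pathToHub-nonempty u u≢hub
      ... | w , rest , eq = subst (λ z → E u z ≡ true) (sym (cong headOrHub eq)) (proj₁ (proj₁ (pathToHub≡⇒simple u eq)))

      parent≡parentOf : ∀ u → u ≢ nothing → Forests.parent u ≡ parentOf u
      parent≡parentOf nothing u≢hub = contradiction refl u≢hub
      parent≡parentOf (just (l , a)) u≢hub =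
        lift-local l a (parentOf (just (l , a))) (E⊆Adj _ _ (edge-parentOf (just (l , a)) u≢hub))

      upEdge⇒E : ∀ u v → Forests.upEdge u v ≡ true → E u v ≡ true
      upEdge⇒E u v e with Forests.upEdge⇒parent u v e
      ... | u≢hub , refl = subst (λ z → E u z ≡ true) (sym (parent≡parentOf u u≢hub)) (edge-parentOf u u≢hub)

      E⇒parentOf : ∀ u v → E u v ≡ true → (u ≢ nothing × parentOf u ≡ v) ⊎ (v ≢ nothing × parentOf v ≡ u)
      E⇒parentOf u v e with u ∈? pathToHub v
      ... | no u∉ = inj₁ (u≢hub , cong headOrHub pathToHub-u)
        where
          u∉′ : u ∉ v ∷ pathToHub v
          u∉′ (here p) = adjacent-irrefl u (subst (Adjacent u) (sym p) (E⊆Adj u v e))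
          u∉′ (there q) = u∉ q
          pathToHub-u : pathToHub u ≡ v ∷ pathToHub v
          pathToHub-u = let (p , d , v↝hub) = pathToHub-simple v in pathToHub-unique u ((e , p) , (u∉′ , d) , v↝hub)
          u≢hub : u ≢ nothing
          u≢hub refl = u∉′ (subst (_∈ v ∷ pathToHub v) (proj₂ (proj₂ (pathToHub-simple v))) (end∈ v (pathToHub v)))
      ... | yes u∈ with pathToHub v in eq
      ...   | s ∷ rest with s ≟ᵛ u
      ...     | yes refl = inj₂ (pathToHub-nonempty⇒≢hub v eq , refl)
      ...     | no s≢u with u∈ | pathToHub≡⇒simple v eq
      ...       | here u≡s | _ = contradiction (sym u≡s) s≢u
      ...       | there u∈rest | p , d , _ = contradiction e (noChord v s rest u p d u∈rest)

      edge≡E : ∀ u v → Forests.edge u v ≡ E u v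
      edge≡E u v with E u v in eq
      ... | true with E⇒parentOf u v eq
      ...   | inj₁ (u≢hub , p) rewrite Forests.parent⇒upEdge u v u≢hub (trans (parent≡parentOf u u≢hub) p) = refl
      ...   | inj₂ (v≢hub , p) rewrite Forests.parent⇒upEdge v u v≢hub (trans (parent≡parentOf v v≢hub) p) =
              ∨-zeroʳ (Forests.upEdge u v)
      edge≡E u v | false with Forests.upEdge u v in e₁ | Forests.upEdge v u in e₂
      ... | true | _ = contradiction (trans (sym eq) (upEdge⇒E u v e₁)) λ ()
      ... | false | true = contradiction (trans (sym eq) (trans (E-sym u v) (upEdge⇒E v u e₂))) λ ()
      ... | false | false = refl

    module Roundtrip (P : ForestFamily) where

      open FromForests P
      module Tree = FromTree tree

      pathToHub-lift-simple : ∀ l {x} (r : ReachesRoot (parentMap l) x) →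
        Distinct (lift l x ∷ proj₁ (pathToHub-lift l r)) × (∀ {w} → w ∈ proj₁ (pathToHub-lift l r) → depth w < depth (lift l x))
      pathToHub-lift-simple l root = ((λ ()) , tt) , λ ()
      pathToHub-lift-simple l (up {a} r) with pathToHub-lift-simple l r
      ... | d , shallower = (x∉ , d) , shallower′
        where
          step : depth (lift l (parentMap l a)) < depth (just (l , a))
          step = ≤-reflexive (sym (depth-parent (just (l , a)) (λ ())))
          shallower′ : ∀ {w} → w ∈ lift l (parentMap l a) ∷ proj₁ (pathToHub-lift l r) → depth w < depth (just (l , a))
          shallower′ (here refl) = step
          shallower′ (there q) = <-trans (shallower q) step
          x∉ : just (l , a) ∉ lift l (parentMap l a) ∷ proj₁ (pathToHub-lift l r)
          x∉ m = <-irrefl refl (shallower′ m)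

      localParent≡parentMap : ∀ l a → Tree.localParent l a ≡ parentMap l a
      localParent≡parentMap l a = trans (cong (local ∘ headOrHub) pathToHub≡) (head-local r)
        where
          r : ReachesRoot (parentMap l) (just a)
          r = proj₂ (P l) a
          pathToHub≡ : Tree.pathToHub (just (l , a)) ≡ proj₁ (pathToHub-lift l r)
          pathToHub≡ = Tree.pathToHub-unique (just (l , a))
            (proj₁ (proj₂ (pathToHub-lift l r)) , proj₁ (pathToHub-lift-simple l r) , proj₂ (proj₂ (pathToHub-lift l r)))
          head-local : ∀ {b} (r : ReachesRoot (parentMap l) (just b)) →
            local (headOrHub (proj₁ (pathToHub-lift l r))) ≡ parentMap l b
          head-local {b} (up r) = local-lift l (parentMap l b)

    edge-cong : ∀ (P Q : ForestFamily) → (∀ l a → proj₁ (P l) a ≡ proj₁ (Q l) a) →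
      ∀ u v → FromForests.edge P u v ≡ FromForests.edge Q u v
    edge-cong P Q eq u v = cong₂ _∨_ (upEdge-cong u v) (upEdge-cong v u)
      where
        parent-cong : ∀ u → FromForests.parent P u ≡ FromForests.parent Q u
        parent-cong nothing = refl
        parent-cong (just (l , a)) = cong (lift l) (eq l a)
        upEdge-cong : ∀ u v → FromForests.upEdge P u v ≡ FromForests.upEdge Q u v
        upEdge-cong nothing v = refl
        upEdge-cong (just x) v = cong (_== v) (parent-cong (just x))

    localParent-cong : ∀ (T₁ T₂ : SpanningTree (≡.setoid Vertex) Adjacent) →
      (∀ u v → SpanningTree.E T₁ u v ≡ SpanningTree.E T₂ u v) →
      ∀ l a → FromTree.localParent T₁ l a ≡ FromTree.localParent T₂ l a
    localParent-cong T₁ T₂ eq l a with FromTree.pathToHub-simple T₂ (just (l , a))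
    ... | p , d , v↝hub = cong (local ∘ headOrHub)
          (FromTree.pathToHub-unique T₁ (just (l , a)) (path-resp (λ u w → sym (eq u w)) _ p , d , v↝hub))

    ForestFamilies↔SpanningTrees : Inverse ForestFamilies (SpanningTreeSetoid (≡.setoid Vertex) Adjacent)
    ForestFamilies↔SpanningTrees = record
      { to = FromForests.tree
      ; from = FromTree.forests
      ; to-cong = λ {P} {Q} → edge-cong P Q
      ; from-cong = λ {T₁} {T₂} → localParent-cong T₁ T₂
      ; inverse = (λ {T} {P} eq u v → trans (edge-cong P (FromTree.forests T) eq u v) (FromTree.edge≡E T u v))
                , (λ {P} {T} eq l a → trans (localParent-cong T (FromForests.tree P) eq l a) (Roundtrip.localParent≡parentMap P l a)) }

module LinearDependenceGraph where

  open import Data.Nat as ℕ using (ℕ; zero; suc)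
  open import Data.Fin using (Fin; zero; suc; punchIn; punchOut; combine; remQuot)
  import Data.Fin.Properties as Fin
  open import Data.Maybe using (Maybe; just; nothing)
  open import Data.Bool using (Bool; true)
  open import Data.Product using (∃; _×_; _,_; proj₁; proj₂)
  open import Data.Unit using (tt)
  open import Relation.Nullary using (¬_; yes; no; Dec; contradiction)
  open import Relation.Binary using (Setoid; Rel)
  open import Relation.Binary.PropositionalEquality as ≡ using (_≡_; _≢_)
  open import Function using (_∘_)
  open import Function.Bundles using (Inverse)
  import Function.Construct.Composition as Comp
  open import Algebra.Bundles using (CommutativeRing)
  import Algebra.Properties.Ring as RingProperties
  import Algebra.Properties.Group as GroupProperties
  open import Defs
  open CayleyFormula using (module Cayley)
  open Windmills using (module Windmill)
  open Cayley using (Fin^↔Fun; pointwise-inverse; cayley)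

  module _ {c ℓ r} {W : Set} (S : Setoid c ℓ) (ι : Inverse (≡.setoid W) S) {Adj : Rel (Setoid.Carrier S) r}
           (Adj-resp : ∀ {x y x′ y′} → Adj x y → Setoid._≈_ S x x′ → Setoid._≈_ S y y′ → Adj x′ y′)
           {Adjᵂ : W → W → Set}
           (Adjᵂ⇒Adj : ∀ u v → Adjᵂ u v → Adj (Inverse.to ι u) (Inverse.to ι v))
           (Adj⇒Adjᵂ : ∀ u v → Adj (Inverse.to ι u) (Inverse.to ι v) → Adjᵂ u v) where

    open Setoid S using (_≈_; refl; sym; trans) renaming (Carrier to V)
    open Inverse ι

    private
      to∘from : ∀ x → to (from x) ≈ x
      to∘from x = inverseˡ ≡.refl

      from∘to : ∀ u → from (to u) ≡ u
      from∘to u = inverseʳ refl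

    pushTree : SpanningTree (≡.setoid W) Adjᵂ → SpanningTree S Adj
    pushTree T = record
      { E = E′
      ; E-resp = λ p q → ≡.cong₂ E (from-cong p) (from-cong q)
      ; E-sym = λ x y → E-sym (from x) (from y)
      ; E⊆Adj = λ x y e → Adj-resp (Adjᵂ⇒Adj _ _ (E⊆Adj _ _ e)) (to∘from x) (to∘from y)
      ; connected = λ x y → start (sym (to∘from x)) (mapWalk (connected (from x) (from y)) (to∘from y))
      ; acyclic = λ { (k , cyc , cyc-inj , edges , closing) → acyclic (k , from ∘ cyc ,
          (λ i j p → cyc-inj i j (trans (sym (to∘from (cyc i))) (trans (to-cong p) (to∘from (cyc j))))) , edges , closing) } }
      where
        open SpanningTree T
        E′ : V → V → Bool
        E′ x y = E (from x) (from y)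
        mapWalk : ∀ {u v y} → Walk (≡.setoid W) E u v → to v ≈ y → Walk S E′ (to u) y
        mapWalk (here p) q = here (trans (to-cong p) q)
        mapWalk {u} (step {w = w} e wk) q = step (≡.subst (_≡ true) (≡.sym (≡.cong₂ E (from∘to u) (from∘to w))) e) (mapWalk wk q)
        start : ∀ {x x′ y} → x ≈ x′ → Walk S E′ x′ y → Walk S E′ x y
        start p (here q) = here (trans p q)
        start p (step e wk) = step (≡.trans (≡.cong₂ E (from-cong p) ≡.refl) e) wk

    pullTree : SpanningTree S Adj → SpanningTree (≡.setoid W) Adjᵂ
    pullTree T = record
      { E = E′
      ; E-resp = λ { ≡.refl ≡.refl → ≡.refl }
      ; E-sym = λ u v → E-sym (to u) (to v)
      ; E⊆Adj = λ u v e → Adj⇒Adjᵂ u v (E⊆Adj _ _ e)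
      ; connected = λ u v → ≡.subst₂ (Walk (≡.setoid W) E′) (from∘to u) (from∘to v) (mapWalk (connected (to u) (to v)))
      ; acyclic = λ { (k , cyc , cyc-inj , edges , closing) → acyclic (k , to ∘ cyc ,
          (λ i j p → cyc-inj i j (≡.trans (≡.sym (from∘to (cyc i))) (≡.trans (from-cong p) (from∘to (cyc j))))) , edges , closing) } }
      where
        open SpanningTree T
        E′ : W → W → Bool
        E′ u v = E (to u) (to v)
        mapWalk : ∀ {x y} → Walk S E x y → Walk (≡.setoid W) E′ (from x) (from y)
        mapWalk (here p) = here (from-cong p)
        mapWalk (step e wk) = step (≡.trans (E-resp (to∘from _) (to∘from _)) e) (mapWalk wk)

    spanningTrees-transport : Inverse (SpanningTreeSetoid (≡.setoid W) Adjᵂ) (SpanningTreeSetoid S Adj)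
    spanningTrees-transport = record
      { to = pushTree
      ; from = pullTree
      ; to-cong = λ eq x y → eq (from x) (from y)
      ; from-cong = λ eq u v → eq (to u) (to v)
      ; inverse = (λ {T} eq x y → ≡.trans (eq (from x) (from y)) (SpanningTree.E-resp T (to∘from x) (to∘from y)))
                , (λ {T} eq u v → ≡.trans (eq (to u) (to v)) (≡.cong₂ (SpanningTree.E T) (from∘to u) (from∘to v))) }

  module FieldProperties {c ℓ} (F : CommutativeRing c ℓ) (isField : IsField F) where

    open CommutativeRing F
    open IsField isField
    open RingProperties ring using (-‿distribˡ-*)
    open import Relation.Binary.Reasoning.Setoid setoid

    *-cancelˡ : ∀ x y u → x * y ≈ 1# → y * (x * u) ≈ u
    *-cancelˡ x y u xy≈1 = begin
      y * (x * u) ≈⟨ *-assoc y x u ⟨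
      (y * x) * u ≈⟨ *-congʳ (trans (*-comm y x) xy≈1) ⟩
      1# * u      ≈⟨ *-identityˡ u ⟩
      u ∎

    *-cancelʳ : ∀ x y u → x * y ≈ 1# → x * (y * u) ≈ u
    *-cancelʳ x y u xy≈1 = *-cancelˡ y x u (trans (*-comm y x) xy≈1)

    x*y≈0⇒y≈0 : ∀ x y → x * y ≈ 0# → ¬ (x ≈ 0#) → y ≈ 0#
    x*y≈0⇒y≈0 x y xy≈0 x≉0 = let (w , xw≈1) = inverse x x≉0 in begin
      y           ≈⟨ *-cancelˡ x w y xw≈1 ⟨
      w * (x * y) ≈⟨ *-congˡ xy≈0 ⟩
      w * 0#      ≈⟨ zeroʳ w ⟩
      0# ∎

    b[au]-a[bu]≈0 : ∀ a b u → b * (a * u) + (- a) * (b * u) ≈ 0#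
    b[au]-a[bu]≈0 a b u = begin
      b * (a * u) + (- a) * (b * u) ≈⟨ +-congˡ (-‿distribˡ-* a (b * u)) ⟨
      b * (a * u) + - (a * (b * u)) ≈⟨ +-congʳ swap ⟩
      a * (b * u) + - (a * (b * u)) ≈⟨ -‿inverseʳ _ ⟩
      0# ∎
      where
        swap : b * (a * u) ≈ a * (b * u)
        swap = begin
          b * (a * u) ≈⟨ *-assoc b a u ⟨
          (b * a) * u ≈⟨ *-congʳ (*-comm b a) ⟩
          (a * b) * u ≈⟨ *-assoc a b u ⟩
          a * (b * u) ∎

  -- the number of lines through 0 in Fⁿ when |F| = q
  lineCount : ℕ → ℕ → ℕ
  lineCount q zero = zero
  lineCount q (suc n) = suc (q ℕ.* lineCount q n)

  module FiniteVectorSpace {c ℓ} (F : CommutativeRing c ℓ) (isField : IsField F) (m : ℕ)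
                           (card : HasCardinality F (suc m)) where

    open CommutativeRing F hiding (zero)
    open IsField isField
    open FieldProperties F isField
    open RingProperties ring using (-‿distribˡ-*; -‿distribʳ-*)
    open GroupProperties +-group using (inverseʳ-unique)
    open import Relation.Binary.Reasoning.Setoid setoid
    module C = Inverse card

    from-to : ∀ i → C.from (C.to i) ≡ i
    from-to i = C.inverseʳ refl

    to-from : ∀ x → C.to (C.from x) ≈ x
    to-from x = C.inverseˡ ≡.refl

    _≈?_ : ∀ x y → Dec (x ≈ y)
    x ≈? y with C.from x Fin.≟ C.from y
    ... | yes p = yes (trans (sym (to-from x)) (trans (C.to-cong p) (to-from y)))
    ... | no ¬p = no (¬p ∘ C.from-cong)

    to-injective : ∀ {i j} → C.to i ≈ C.to j → i ≡ j
    to-injective {i} {j} p = ≡.trans (≡.sym (from-to i)) (≡.trans (C.from-cong p) (from-to j))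

    unit : Fin m → Carrier
    unit a = C.to (punchIn (C.from 0#) a)

    unit≉0 : ∀ a → ¬ (unit a ≈ 0#)
    unit≉0 a p = Fin.punchInᵢ≢i (C.from 0#) a (≡.trans (≡.sym (from-to _)) (C.from-cong p))

    private
      index0≢ : ∀ x → ¬ (x ≈ 0#) → C.from 0# ≢ C.from x
      index0≢ x x≉0 p = x≉0 (trans (sym (to-from x)) (trans (C.to-cong (≡.sym p)) (to-from 0#)))

    unitIndex : (x : Carrier) → ¬ (x ≈ 0#) → Fin m
    unitIndex x x≉0 = punchOut (index0≢ x x≉0)

    unit-unitIndex : ∀ x x≉0 → unit (unitIndex x x≉0) ≈ x
    unit-unitIndex x x≉0 = trans (C.to-cong (Fin.punchIn-punchOut (index0≢ x x≉0))) (to-from x)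

    unitIndex-cong : ∀ {x y} x≉0 y≉0 → x ≈ y → unitIndex x x≉0 ≡ unitIndex y y≉0
    unitIndex-cong _ _ p = Fin.punchOut-cong (C.from 0#) (C.from-cong p)

    unitIndex-unit : ∀ a a≉0 → unitIndex (unit a) a≉0 ≡ a
    unitIndex-unit a _ = ≡.trans (Fin.punchOut-cong (C.from 0#) (from-to _)) (Fin.punchOut-punchIn (C.from 0#))

    unit⁻¹ : Fin m → Carrier
    unit⁻¹ a = proj₁ (inverse (unit a) (unit≉0 a))

    unit*unit⁻¹ : ∀ a → unit a * unit⁻¹ a ≈ 1#
    unit*unit⁻¹ a = proj₂ (inverse (unit a) (unit≉0 a))

    splitLine : ∀ {L} → Fin (suc (suc m ℕ.* L)) → Maybe (Fin (suc m) × Fin L)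
    splitLine zero = nothing
    splitLine {L} (suc i) = just (remQuot L i)

    joinLine : ∀ {L} → Maybe (Fin (suc m) × Fin L) → Fin (suc (suc m ℕ.* L))
    joinLine nothing = zero
    joinLine (just (t , l)) = suc (combine t l)

    splitLine-joinLine : ∀ {L} s → splitLine {L} (joinLine s) ≡ s
    splitLine-joinLine nothing = ≡.refl
    splitLine-joinLine (just (t , l)) = ≡.cong just (Fin.remQuot-combine t l)

    joinLine-splitLine : ∀ {L} l → joinLine (splitLine {L} l) ≡ l
    joinLine-splitLine zero = ≡.refl
    joinLine-splitLine {L} (suc i) = ≡.cong suc (Fin.combine-remQuot {suc m} L i)

    -- direction n l spans the l-th line of Fⁿ and is normalised to have last nonzero coordinate 1:
    -- a line of Fⁿ⁺¹ is either spanned by (1, 0, …, 0) or by (t, v) with v normalised in Fⁿ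
    mutual
      direction : ∀ n → Fin (lineCount (suc m) n) → Fin n → Carrier
      direction (suc n) l = direction′ n (splitLine l)

      direction′ : ∀ n → Maybe (Fin (suc m) × Fin (lineCount (suc m) n)) → Fin (suc n) → Carrier
      direction′ n nothing zero = 1#
      direction′ n nothing (suc i) = 0#
      direction′ n (just (t , l)) zero = C.to t
      direction′ n (just (t , l)) (suc i) = direction n l i

    direction-joinLine : ∀ n s i → direction (suc n) (joinLine s) i ≡ direction′ n s i
    direction-joinLine n s i = ≡.cong (λ s → direction′ n s i) (splitLine-joinLine s)

    mutual
      direction-has-1 : ∀ n l → ∃ λ i → direction n l i ≈ 1#
      direction-has-1 (suc n) l = direction′-has-1 n (splitLine l)

      direction′-has-1 : ∀ n s → ∃ λ i → direction′ n s i ≈ 1#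
      direction′-has-1 n nothing = zero , refl
      direction′-has-1 n (just (t , l)) = let (i , p) = direction-has-1 n l in suc i , p

    direction′-scaled⇒≡ : ∀ n s s′ γ → (∀ i → direction′ n s′ i ≈ γ * direction′ n s i) → s ≡ s′
    direction-scaled⇒≡ : ∀ n l l′ γ → (∀ i → direction n l′ i ≈ γ * direction n l i) → l ≡ l′
    direction-scaled⇒≡ (suc n) l l′ γ p = ≡.trans (≡.sym (joinLine-splitLine l))
      (≡.trans (≡.cong joinLine (direction′-scaled⇒≡ n (splitLine l) (splitLine l′) γ p)) (joinLine-splitLine l′))

    direction′-scaled⇒≡ n nothing nothing γ p = ≡.refl
    direction′-scaled⇒≡ n nothing (just (t′ , l′)) γ p with direction-has-1 n l′
    ... | i , dᵢ≈1 = contradiction (sym (begin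
      1#               ≈⟨ dᵢ≈1 ⟨
      direction n l′ i ≈⟨ p (suc i) ⟩
      γ * 0#           ≈⟨ zeroʳ γ ⟩
      0# ∎)) 0≉1
    direction′-scaled⇒≡ n (just (t , l)) nothing γ p with direction-has-1 n l
    ... | i , dᵢ≈1 = contradiction (sym (begin
      1#            ≈⟨ p zero ⟩
      γ * C.to t    ≈⟨ *-congʳ γ≈0 ⟩
      0# * C.to t   ≈⟨ zeroˡ _ ⟩
      0# ∎)) 0≉1
      where
        γ≈0 : γ ≈ 0#
        γ≈0 = sym (trans (p (suc i)) (trans (*-congˡ dᵢ≈1) (*-identityʳ γ)))
    direction′-scaled⇒≡ n (just (t , l)) (just (t′ , l′)) γ p
      with direction-scaled⇒≡ n l l′ γ (p ∘ suc) | direction-has-1 n l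
    ... | ≡.refl | i , dᵢ≈1 = ≡.cong (λ t → just (t , l)) (to-injective (sym (begin
      C.to t′       ≈⟨ p zero ⟩
      γ * C.to t    ≈⟨ *-congʳ γ≈1 ⟩
      1# * C.to t   ≈⟨ *-identityˡ _ ⟩
      C.to t ∎)))
      where
        γ≈1 : γ ≈ 1#
        γ≈1 = begin
          γ                   ≈⟨ *-identityʳ γ ⟨
          γ * 1#              ≈⟨ *-congˡ dᵢ≈1 ⟨
          γ * direction n l i ≈⟨ p (suc i) ⟨
          direction n l i     ≈⟨ dᵢ≈1 ⟩
          1# ∎

    Vertex : ℕ → Set
    Vertex n = Windmill.Vertex (lineCount (suc m) n) m

    Adjacent : ∀ n → Vertex n → Vertex n → Set
    Adjacent n = Windmill.Adjacent (lineCount (suc m) n) m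

    toVector : ∀ n → Vertex n → Fin n → Carrier
    toVector n nothing i = 0#
    toVector n (just (l , a)) i = unit a * direction n l i

    normalise-step : ∀ n → (Fin (suc n) → Carrier) → Vertex n → Vertex (suc n)
    normalise-step n x nothing with x zero ≈? 0#
    ... | yes _ = nothing
    ... | no x₀≉0 = just (joinLine nothing , unitIndex (x zero) x₀≉0)
    normalise-step n x (just (l , a)) = just (joinLine (just (C.from (unit⁻¹ a * x zero) , l)) , a)

    normalise : ∀ n → (Fin n → Carrier) → Vertex n
    normalise zero x = nothing
    normalise (suc n) x = normalise-step n x (normalise n (x ∘ suc))

    toVector-normalise-step : ∀ n x v → (∀ i → toVector n v i ≈ x (suc i)) →
      ∀ i → toVector (suc n) (normalise-step n x v) i ≈ x i
    toVector-normalise-step n x nothing tail i with x zero ≈? 0#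
    toVector-normalise-step n x nothing tail zero | yes x₀≈0 = sym x₀≈0
    toVector-normalise-step n x nothing tail (suc i) | yes _ = tail i
    toVector-normalise-step n x nothing tail zero | no x₀≉0 = trans (*-identityʳ _) (unit-unitIndex (x zero) x₀≉0)
    toVector-normalise-step n x nothing tail (suc i) | no _ = trans (zeroʳ _) (tail i)
    toVector-normalise-step n x (just (l , a)) tail zero = begin
      unit a * direction (suc n) (joinLine s) zero ≡⟨ ≡.cong (unit a *_) (direction-joinLine n s zero) ⟩
      unit a * C.to (C.from (unit⁻¹ a * x zero))   ≈⟨ *-congˡ (to-from _) ⟩
      unit a * (unit⁻¹ a * x zero)                 ≈⟨ *-cancelʳ (unit a) (unit⁻¹ a) (x zero) (unit*unit⁻¹ a) ⟩
      x zero ∎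
      where s = just (C.from (unit⁻¹ a * x zero) , l)
    toVector-normalise-step n x (just (l , a)) tail (suc i) =
      trans (reflexive (≡.cong (unit a *_) (direction-joinLine n (just (C.from (unit⁻¹ a * x zero) , l)) (suc i)))) (tail i)

    toVector-normalise : ∀ n x i → toVector n (normalise n x) i ≈ x i
    toVector-normalise (suc n) x = toVector-normalise-step n x (normalise n (x ∘ suc)) (toVector-normalise n (x ∘ suc))

    normalise-step-cong : ∀ n {x y} → (∀ i → x i ≈ y i) → ∀ v → normalise-step n x v ≡ normalise-step n y v
    normalise-step-cong n {x} {y} p nothing with x zero ≈? 0# | y zero ≈? 0#
    ... | yes _ | yes _ = ≡.refl
    ... | yes x₀≈0 | no y₀≉0 = contradiction (trans (sym (p zero)) x₀≈0) y₀≉0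
    ... | no x₀≉0 | yes y₀≈0 = contradiction (trans (p zero) y₀≈0) x₀≉0
    ... | no x₀≉0 | no y₀≉0 = ≡.cong (λ a → just (joinLine nothing , a)) (unitIndex-cong x₀≉0 y₀≉0 (p zero))
    normalise-step-cong n p (just (l , a)) =
      ≡.cong (λ t → just (joinLine (just (t , l)) , a)) (C.from-cong (*-congˡ (p zero)))

    normalise-cong : ∀ n {x y} → (∀ i → x i ≈ y i) → normalise n x ≡ normalise n y
    normalise-cong zero p = ≡.refl
    normalise-cong (suc n) {x} {y} p =
      ≡.trans (≡.cong (normalise-step n x) (normalise-cong n (p ∘ suc))) (normalise-step-cong n p (normalise n (y ∘ suc)))

    mutual
      normalise-toVector : ∀ n v → normalise n (toVector n v) ≡ v
      normalise-toVector zero nothing = ≡.refl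
      normalise-toVector (suc n) nothing rewrite normalise-toVector n nothing with 0# ≈? 0#
      ... | yes _ = ≡.refl
      ... | no 0≉0 = contradiction refl 0≉0
      normalise-toVector (suc n) (just (l , a)) =
        ≡.trans (normalise-direction′ n (splitLine l) a) (≡.cong (λ l → just (l , a)) (joinLine-splitLine l))

      normalise-direction′ : ∀ n s a → normalise (suc n) (λ i → unit a * direction′ n s i) ≡ just (joinLine s , a)
      normalise-direction′ n nothing a =
        ≡.trans (≡.cong (normalise-step n x) tail) head
        where
          x : Fin (suc n) → Carrier
          x i = unit a * direction′ n nothing i
          tail : normalise n (x ∘ suc) ≡ nothing
          tail = ≡.trans (normalise-cong n (λ i → zeroʳ (unit a))) (normalise-toVector n nothing)
          head : normalise-step n x nothing ≡ just (joinLine nothing , a)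
          head with x zero ≈? 0#
          ... | yes x₀≈0 = contradiction (trans (sym (*-identityʳ _)) x₀≈0) (unit≉0 a)
          ... | no x₀≉0 = ≡.cong (λ b → just (joinLine nothing , b))
                           (≡.trans (unitIndex-cong x₀≉0 (unit≉0 a) (*-identityʳ _)) (unitIndex-unit a (unit≉0 a)))
      normalise-direction′ n (just (t , l)) a =
        ≡.trans (≡.cong (normalise-step n x) (normalise-toVector n (just (l , a)))) head
        where
          x : Fin (suc n) → Carrier
          x i = unit a * direction′ n (just (t , l)) i
          head : normalise-step n x (just (l , a)) ≡ just (joinLine (just (t , l)) , a)
          head = ≡.cong (λ t′ → just (joinLine (just (t′ , l)) , a))
                   (≡.trans (C.from-cong (*-cancelˡ (unit a) (unit⁻¹ a) _ (unit*unit⁻¹ a))) (from-to t))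

    Vertex↔Vector : ∀ n → Inverse (≡.setoid (Vertex n)) (VecSetoid F n)
    Vertex↔Vector n = record
      { to = toVector n
      ; from = normalise n
      ; to-cong = λ { ≡.refl i → refl }
      ; from-cong = normalise-cong n
      ; inverse = (λ {x} p i → trans (reflexive (≡.cong (λ v → toVector n v i) p)) (toVector-normalise n x i))
                , (λ {v} p → ≡.trans (normalise-cong n p) (normalise-toVector n v)) }

    linDep⇒proportional : ∀ n (x y : Fin n → Carrier) → LinDep F n x y → (∃ λ j → ¬ (x j ≈ 0#)) →
      ∃ λ γ → ∀ i → y i ≈ γ * x i
    linDep⇒proportional n x y (λ₁ , λ₂ , nontrivial , relation) (j , xⱼ≉0) with λ₂ ≈? 0#
    ... | yes λ₂≈0 = contradiction (x*y≈0⇒y≈0 λ₁ (x j) λ₁xⱼ≈0 (λ λ₁≈0 → nontrivial (λ₁≈0 , λ₂≈0))) xⱼ≉0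
      where
        λ₁xⱼ≈0 : λ₁ * x j ≈ 0#
        λ₁xⱼ≈0 = begin
          λ₁ * x j            ≈⟨ +-identityʳ _ ⟨
          λ₁ * x j + 0#       ≈⟨ +-congˡ (trans (sym (zeroˡ (y j))) (*-congʳ (sym λ₂≈0))) ⟩
          λ₁ * x j + λ₂ * y j ≈⟨ relation j ⟩
          0# ∎
    ... | no λ₂≉0 with inverse λ₂ λ₂≉0
    ...   | μ , λ₂μ≈1 = - (μ * λ₁) , λ i → begin
          y i                ≈⟨ *-cancelˡ λ₂ μ (y i) λ₂μ≈1 ⟨
          μ * (λ₂ * y i)     ≈⟨ *-congˡ (inverseʳ-unique (λ₁ * x i) (λ₂ * y i) (relation i)) ⟩
          μ * (- (λ₁ * x i)) ≈⟨ -‿distribʳ-* μ (λ₁ * x i) ⟨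
          - (μ * (λ₁ * x i)) ≈⟨ -‿cong (*-assoc μ λ₁ (x i)) ⟨
          - ((μ * λ₁) * x i) ≈⟨ -‿distribˡ-* (μ * λ₁) (x i) ⟩
          (- (μ * λ₁)) * x i ∎

    toVector-nonzero : ∀ n l a → ∃ λ i → ¬ (toVector n (just (l , a)) i ≈ 0#)
    toVector-nonzero n l a with direction-has-1 n l
    ... | i , dᵢ≈1 = i , λ p → unit≉0 a (trans (sym (trans (*-congˡ dᵢ≈1) (*-identityʳ _))) p)

    ΓAdj-resp : ∀ n {x y x′ y′} → ΓAdj F n x y → (∀ i → x i ≈ x′ i) → (∀ i → y i ≈ y′ i) → ΓAdj F n x′ y′
    ΓAdj-resp n (x≉y , (λ₁ , λ₂ , nontrivial , relation)) p q =
      (λ x′≈y′ → x≉y (λ i → trans (p i) (trans (x′≈y′ i) (sym (q i))))) ,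
      (λ₁ , λ₂ , nontrivial , λ i → trans (+-cong (*-congˡ (sym (p i))) (*-congˡ (sym (q i)))) (relation i))

    toVector-injective : ∀ n {u v} → (∀ i → toVector n u i ≈ toVector n v i) → u ≡ v
    toVector-injective n {u} {v} p = ≡.trans (≡.sym (normalise-toVector n u)) (≡.trans (normalise-cong n p) (normalise-toVector n v))

    adjacent⇒ΓAdj : ∀ n u v → Adjacent n u v → ΓAdj F n (toVector n u) (toVector n v)
    adjacent⇒ΓAdj n u v adj = distinct , linDep u v adj
      where
        distinct : ¬ (∀ i → toVector n u i ≈ toVector n v i)
        distinct p = Windmill.adjacent-irrefl (lineCount (suc m) n) m u (≡.subst (Adjacent n u) (≡.sym (toVector-injective n p)) adj)
        linDep : ∀ u v → Adjacent n u v → LinDep F n (toVector n u) (toVector n v)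
        linDep nothing (just _) _ = 1# , 0# , (λ (1≈0 , _) → 0≉1 (sym 1≈0)) , λ i → trans (+-cong (zeroʳ 1#) (zeroˡ _)) (+-identityʳ 0#)
        linDep (just _) nothing _ = 0# , 1# , (λ (_ , 1≈0) → 0≉1 (sym 1≈0)) , λ i → trans (+-cong (zeroˡ _) (zeroʳ 1#)) (+-identityʳ 0#)
        linDep (just (l , a)) (just (.l , b)) (≡.refl , _) =
          unit b , - unit a , (λ (b≈0 , _) → unit≉0 b b≈0) , λ i → b[au]-a[bu]≈0 (unit a) (unit b) (direction n l i)

    ΓAdj⇒adjacent : ∀ n u v → ΓAdj F n (toVector n u) (toVector n v) → Adjacent n u v
    ΓAdj⇒adjacent n nothing nothing (u≉v , _) = u≉v (λ i → refl)
    ΓAdj⇒adjacent n nothing (just _) _ = tt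
    ΓAdj⇒adjacent n (just _) nothing _ = tt
    ΓAdj⇒adjacent n (just (l , a)) (just (l′ , b)) (u≉v , dep)
      with linDep⇒proportional n _ _ dep (toVector-nonzero n l a)
    ... | γ , v≈γu with direction-scaled⇒≡ n l l′ (unit⁻¹ b * (γ * unit a)) scaled
      where
        scaled : ∀ i → direction n l′ i ≈ (unit⁻¹ b * (γ * unit a)) * direction n l i
        scaled i = begin
          direction n l′ i                       ≈⟨ *-cancelˡ (unit b) (unit⁻¹ b) _ (unit*unit⁻¹ b) ⟨
          unit⁻¹ b * (unit b * direction n l′ i)  ≈⟨ *-congˡ (v≈γu i) ⟩
          unit⁻¹ b * (γ * (unit a * direction n l i)) ≈⟨ *-congˡ (*-assoc γ (unit a) _) ⟨
          unit⁻¹ b * ((γ * unit a) * direction n l i) ≈⟨ *-assoc (unit⁻¹ b) _ _ ⟨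
          (unit⁻¹ b * (γ * unit a)) * direction n l i ∎
    ...   | ≡.refl = ≡.refl , λ { ≡.refl → u≉v (λ i → refl) }

  windmill-spanningTrees : ∀ L s →
    NumberOfSpanningTrees (≡.setoid (Windmill.Vertex L (suc s))) (Windmill.Adjacent L (suc s)) ((suc (suc s) ℕ.^ s) ℕ.^ L)
  windmill-spanningTrees L s = Comp.inverse (Fin^↔Fun (suc (suc s) ℕ.^ s) L)
    (Comp.inverse (pointwise-inverse L (cayley s)) (Windmill.ForestFamilies↔SpanningTrees L (suc s)))

open import Defs
open import Level using (Level)
open import Data.Nat using (ℕ; zero; suc; _≤_; _∸_; _*_; _^_; _+_)
open import Data.Nat.Properties using (*-zeroʳ; *-distribˡ-+; ^-*-assoc)
open import Data.Fin using (Fin; zero)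
open import Data.List using (map; applyUpTo)
open import Data.Nat.ListAction using (sum)
open import Relation.Nullary using (¬_; contradiction)
open import Relation.Binary.PropositionalEquality as ≡ using (_≡_; cong; sym; trans)
open import Function using (_∘_; id)
open import Function.Bundles using (Inverse)
import Function.Construct.Composition as Comp
open import Algebra.Bundles using (CommutativeRing)
open LinearDependenceGraph

sum-map-^-suc : ∀ q f n → sum (map (q ^_) (applyUpTo (suc ∘ f) n)) ≡ q * sum (map (q ^_) (applyUpTo f n))
sum-map-^-suc q f zero = sym (*-zeroʳ q)
sum-map-^-suc q f (suc n) = trans (cong (q * q ^ f 0 +_) (sum-map-^-suc q (f ∘ suc) n))
  (sym (*-distribˡ-+ q (q ^ f 0) _))

geomSum≡lineCount : ∀ q n → geomSum q n ≡ lineCount q n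
geomSum≡lineCount q zero = ≡.refl
geomSum≡lineCount q (suc n) = cong suc (trans (sum-map-^-suc q id n) (cong (q *_) (geomSum≡lineCount q n)))

module _ {c ℓ} (F : CommutativeRing c ℓ) where

  open CommutativeRing F

  ¬cardinality-0 : ¬ HasCardinality F 0
  ¬cardinality-0 card with Inverse.from card 0#
  ... | ()

  ¬cardinality-1 : IsField F → ¬ HasCardinality F 1
  ¬cardinality-1 isField card = IsField.0≉1 isField (begin
    0#                          ≈⟨ inverseˡ ≡.refl ⟨
    to (from 0#)                ≡⟨ cong to (one (from 0#) (from 1#)) ⟩
    to (from 1#)                ≈⟨ inverseˡ ≡.refl ⟩
    1# ∎)
    where
      open Inverse card
      open import Relation.Binary.Reasoning.Setoid setoid
      one : ∀ (i j : Fin 1) → i ≡ j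
      one zero zero = ≡.refl

mainTheorem13 : ∀ {c ℓ : Level} (F : CommutativeRing c ℓ) → IsField F →
    (q : ℕ) → HasCardinality F q →
    (n : ℕ) → 1 ≤ n →
    NumberOfSpanningTrees (VecSetoid F n) (ΓAdj F n) (q ^ ((q ∸ 2) * geomSum q n))
mainTheorem13 F isField zero card n _ = contradiction card (¬cardinality-0 F)
mainTheorem13 F isField (suc zero) card n _ = contradiction card (¬cardinality-1 F isField)
mainTheorem13 F isField (suc (suc s)) card n _ =
  ≡.subst (NumberOfSpanningTrees (VecSetoid F n) (ΓAdj F n)) (sym exponent)
    (Comp.inverse (windmill-spanningTrees (lineCount q n) s)
      (spanningTrees-transport (VecSetoid F n) (Vertex↔Vector n) (ΓAdj-resp n) (adjacent⇒ΓAdj n) (ΓAdj⇒adjacent n)))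
  where
    open FiniteVectorSpace F isField (suc s) card
    q : ℕ
    q = suc (suc s)
    exponent : q ^ (s * geomSum q n) ≡ (q ^ s) ^ lineCount q n
    exponent = trans (cong (λ L → q ^ (s * L)) (geomSum≡lineCount q n)) (sym (^-*-assoc q s (lineCount q n)))
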